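{- Let $\mathcal{R}$ be a finite valuation ring of order $q^r$, and let $F,G\subseteq\mathcal{R}^d$ with $F\cap(\mathcal{R}^0)^d=\emptyset$. For $t\in\mathcal{R}$ let \[\nu(t)=|\{(\mathbf{x},\mathbf{y})\in F\times G\colon \mathbf{x}\cdot\mathbf{y}=t\}|.\] Then \[\sum_{t\in\mathcal{R}}\nu(t)^2\le\frac{|F|^2|G|^2}{q^r}+q^{(d-1)(2r-1)}|F||G|\cdot\max_{\mathbf{x}\in\mathcal{R}^d\setminus(\mathcal{R}^0)^d}|F\cap l_{\mathbf{x}}|,\] where $l_{\mathbf{x}}=\{s\mathbf{x}\colon s\in\mathcal{R}^*\}$.
   Context: $\mathcal{R}$ is a finite valuation ring: a finite commutative local ring with identity whose ideals are totally ordered by inclusion (a finite chain ring); its residue field has $q$ elements, $q$ an odd prime power, and $|\mathcal{R}|=q^r$. $\mathcal{R}^*$ denotes the units and $\mathcal{R}^0$ the non-units of $\mathcal{R}$. For $\mathbf{x},\mathbf{y}\in\mathcal{R}^d$, $\mathbf{x}\cdot\mathbf{y}=x_1y_1+\cdots+x_dy_d$. -}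

module Defs where

open import Level using (0ℓ)
open import Data.Nat using (ℕ; zero; suc; _⊔_)
import Data.Nat as N
open import Data.Nat.Primality using (Prime)
open import Data.Product using (Σ; ∃; _×_; _,_)
open import Data.Sum using (_⊎_)
open import Data.Empty using (⊥)
open import Data.Nat.ListAction using (sum)
open import Data.List using (List; []; _∷_; length; filter; map; foldr; cartesianProduct; concatMap)
open import Data.List.Membership.Propositional using (_∈_)
open import Data.List.Relation.Unary.Unique.Propositional using (Unique)
open import Data.List.Relation.Unary.Any using (Any; any?)
open import Data.Vec using (Vec; []; _∷_; lookup)
import Data.Vec as Vec
open import Data.Vec.Relation.Unary.All as VAll using ()
open import Data.Fin using (Fin)
open import Relation.Nullary using (¬_; Dec; yes; no)
open import Relation.Nullary.Decidable using (_×-dec_; ¬?)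
open import Relation.Unary using (Pred; Decidable)
open import Relation.Binary using (DecidableEquality)
open import Relation.Binary.PropositionalEquality using (_≡_; _≢_)
open import Algebra.Structures using (IsCommutativeRing)
import Data.Vec.Properties as VecP

record Ideal {A : Set} (_+_ _*_ : A → A → A) (0# : A) : Set₁ where
  field
    member  : A → Set
    0∈      : member 0#
    +-closed : ∀ {x y} → member x → member y → member (x + y)
    *-closed : ∀ (r : A) {x} → member x → member (r * x)

_⊆ᴵ_ : ∀ {A : Set} {_+_ _*_ : A → A → A} {0# : A} →
       Ideal _+_ _*_ 0# → Ideal _+_ _*_ 0# → Set
I ⊆ᴵ J = ∀ x → Ideal.member I x → Ideal.member J x

-- A finite valuation ring (finite chain ring): a finite commutative local
-- ring with 1 ≠ 0 whose ideals are totally ordered by inclusion.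

record FiniteChainRing : Set₁ where
  infixl 7 _*_
  infixl 6 _+_
  field
    Carrier : Set
    _+_ _*_ : Carrier → Carrier → Carrier
    -_      : Carrier → Carrier
    0# 1#   : Carrier
    isCommutativeRing : IsCommutativeRing _≡_ _+_ _*_ -_ 0# 1#
    1≢0     : 1# ≢ 0#
    _≟_      : DecidableEquality Carrier
    elems    : List Carrier
    complete : ∀ x → x ∈ elems
    unique   : Unique elems

  IsUnit : Carrier → Set
  IsUnit x = ∃ λ y → x * y ≡ 1#

  NonUnit : Carrier → Set
  NonUnit x = ¬ IsUnit x

  field
    -- local: the non-units form an ideal (closure under addition;
    -- closure under multiplication by ring elements is automatic)
    local : ∀ {x y} → NonUnit x → NonUnit y → NonUnit (x + y)
    chain : ∀ (I J : Ideal _+_ _*_ 0#) → I ⊆ᴵ J ⊎ J ⊆ᴵ I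

module FCR (R : FiniteChainRing) where
  open FiniteChainRing R public

  isUnit? : Decidable IsUnit
  isUnit? x with any? (λ y → (x * y) ≟ 1#) elems
  ... | yes p = yes (go p)
    where
      go : ∀ {ys} → Any (λ y → x * y ≡ 1#) ys → IsUnit x
      go (Any.here e) = _ , e
      go (Any.there a) = go a
  ... | no ¬p = no λ { (y , e) → ¬p (lem y e (complete y)) }
    where
      lem : ∀ y → x * y ≡ 1# → ∀ {ys} → y ∈ ys → Any (λ z → x * z ≡ 1#) ys
      lem y e (Any.here refl') = Any.here (subst' refl' e)
        where subst' : ∀ {a b} → a ≡ b → x * a ≡ 1# → x * b ≡ 1#
              subst' Relation.Binary.PropositionalEquality.refl h = h
      lem y e (Any.there m) = Any.there (lem y e m)

  nonUnit? : Decidable NonUnit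
  nonUnit? x = ¬? (isUnit? x)

  card : ℕ
  card = length elems

  cardNonUnits : ℕ
  cardNonUnits = length (filter nonUnit? elems)

  allVec : (d : ℕ) → List (Vec Carrier d)
  allVec zero    = [] ∷ []
  allVec (suc d) = concatMap (λ a → map (a ∷_) (allVec d)) elems

  _≟ᵛ_ : ∀ {d} → DecidableEquality (Vec Carrier d)
  _≟ᵛ_ = VecP.≡-dec _≟_

  _·_ : ∀ {d} → Vec Carrier d → Vec Carrier d → Carrier
  []       · []       = 0#
  (a ∷ xs) · (b ∷ ys) = a * b + xs · ys

  _•_ : ∀ {d} → Carrier → Vec Carrier d → Vec Carrier d
  s • x = Vec.map (s *_) x

  AllNonUnit : ∀ {d} → Vec Carrier d → Set
  AllNonUnit = VAll.All NonUnit

  allNonUnit? : ∀ {d} → Decidable (AllNonUnit {d})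
  allNonUnit? = VAll.all? nonUnit?

  InLine : ∀ {d} → Vec Carrier d → Vec Carrier d → Set
  InLine x y = ∃ λ s → IsUnit s × y ≡ s • x

  inLine? : ∀ {d} (x : Vec Carrier d) → Decidable (InLine x)
  inLine? x y with any? (λ s → isUnit? s ×-dec (y ≟ᵛ (s • x))) elems
  ... | yes p = yes (go p)
    where
      go : ∀ {ss} → Any (λ s → IsUnit s × y ≡ s • x) ss → InLine x y
      go (Any.here h) = _ , h
      go (Any.there a) = go a
  ... | no ¬p = no λ { (s , h) → ¬p (lem s h (complete s)) }
    where
      lem : ∀ s → IsUnit s × y ≡ s • x → ∀ {ss} → s ∈ ss → Any (λ t → IsUnit t × y ≡ t • x) ss
      lem s h (Any.here Relation.Binary.PropositionalEquality.refl) = Any.here h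
      lem s h (Any.there m) = Any.there (lem s h m)

  count : ∀ {d} {P : Pred (Vec Carrier d) 0ℓ} → Decidable P → ℕ
  count {d} P? = length (filter P? (allVec d))

  ν : ∀ {d} {F G : Pred (Vec Carrier d) 0ℓ} → Decidable F → Decidable G → Carrier → ℕ
  ν {d} F? G? t =
    length (filter (λ p → (F? (Data.Product.proj₁ p) ×-dec G? (Data.Product.proj₂ p))
                          ×-dec ((Data.Product.proj₁ p · Data.Product.proj₂ p) ≟ t))
                   (cartesianProduct (allVec d) (allVec d)))

  sumν² : ∀ {d} {F G : Pred (Vec Carrier d) 0ℓ} → Decidable F → Decidable G → ℕ
  sumν² F? G? = sum (map (λ t → ν F? G? t N.* ν F? G? t) elems)

  -- max_{x ∈ R^d \ (R^0)^d} |F ∩ l_x|   (maximum of the empty family is 0)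
  maxLine : ∀ {d} {F : Pred (Vec Carrier d) 0ℓ} → Decidable F → ℕ
  maxLine {d} F? =
    foldr _⊔_ 0 (map (λ x → count (λ y → F? y ×-dec inLine? x y))
                     (filter (λ x → ¬? (allNonUnit? x)) (allVec d)))

OddPrimePower : ℕ → Set
OddPrimePower q = ∃ λ p → ∃ λ k → Prime p × p ≢ 2 × 1 Data.Nat.≤ k × q ≡ p N.^ k

-- Write ν(t) = Σ_{x∈F} νₓ(t) with νₓ(t) = #{y ∈ G : x·y = t}. The dispersion form of
-- Cauchy–Schwarz bounds |R| Σ_t ν(t)² by (|F||G|)² plus |F| times the total excess
-- Σ_{x∈F} (|R| Σ_t νₓ(t)² − |G|²). The excess of x is invariant under x ↦ u x for units u,
-- and every x ∈ F is unimodular, so averaging over units bounds the total excess by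
-- max_z |F ∩ l_z| / |R^*| times the excess summed over all unimodular z. That sum counts
-- pairs y, y' ∈ G against the number of unimodular z orthogonal to y − y', which depends
-- only on the largest k with y − y' ∈ π^k R^d; the pairs with y − y' ∈ π^k R^d number at
-- most |G| q^{(r−k)d}, and summing over k gives the factor q^{(d−1)(2r−1)}.
module Submission where

open import Defs
import Level
import Data.Nat
import Data.Vec
import Relation.Unary
import Relation.Nullary
import Relation.Binary.PropositionalEquality as PEq

module FiniteSums where

  open import Data.Nat using (ℕ; suc; _+_; _*_; _≤_; z≤n; s≤s)
  open import Data.Nat.Properties
  open import Data.Nat.Tactic.RingSolver using (solve-∀)
  open import Data.List using (List; []; _∷_; length; filter; map; concatMap; _++_; cartesianProduct)
  open import Data.List.Membership.Propositional using (_∈_)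
  open import Data.List.Relation.Unary.Any using (here; there)
  open import Data.List.Relation.Unary.All as All using (All; []; _∷_)
  open import Data.List.Relation.Unary.Unique.Propositional using (Unique)
  open import Data.List.Relation.Unary.AllPairs using ([]; _∷_)
  open import Data.Nat.ListAction using (sum)
  open import Data.Product using (_×_; _,_)
  open import Data.Empty using (⊥-elim)
  open import Function using (_∘_)
  open import Relation.Nullary using (¬_; Dec; yes; no)
  open import Relation.Nullary.Decidable using (_×-dec_)
  open import Relation.Unary using (Pred; Decidable)
  open import Relation.Binary using (DecidableEquality)
  open import Relation.Binary.PropositionalEquality

  private variable
    A B : Set

  ∑ : List A → (A → ℕ) → ℕ
  ∑ [] f = 0
  ∑ (a ∷ l) f = f a + ∑ l f

  𝟙 : ∀ {P : Set} → Dec P → ℕ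
  𝟙 (yes _) = 1
  𝟙 (no _) = 0

  𝟙-yes : ∀ {P : Set} (d : Dec P) → P → 𝟙 d ≡ 1
  𝟙-yes (yes _) _ = refl
  𝟙-yes (no ¬p) p = ⊥-elim (¬p p)

  𝟙-no : ∀ {P : Set} (d : Dec P) → ¬ P → 𝟙 d ≡ 0
  𝟙-no (yes p) ¬p = ⊥-elim (¬p p)
  𝟙-no (no _) _ = refl

  𝟙≤1 : ∀ {P : Set} (d : Dec P) → 𝟙 d ≤ 1
  𝟙≤1 (yes _) = s≤s z≤n
  𝟙≤1 (no _) = z≤n

  𝟙-cong : ∀ {P Q : Set} (d : Dec P) (e : Dec Q) → (P → Q) → (Q → P) → 𝟙 d ≡ 𝟙 e
  𝟙-cong (yes p) (yes q) f g = refl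
  𝟙-cong (yes p) (no ¬q) f g = ⊥-elim (¬q (f p))
  𝟙-cong (no ¬p) (yes q) f g = ⊥-elim (¬p (g q))
  𝟙-cong (no ¬p) (no ¬q) f g = refl

  𝟙-mono : ∀ {P Q : Set} (d : Dec P) (e : Dec Q) → (P → Q) → 𝟙 d ≤ 𝟙 e
  𝟙-mono (yes p) (yes q) f = ≤-refl
  𝟙-mono (yes p) (no ¬q) f = ⊥-elim (¬q (f p))
  𝟙-mono (no ¬p) e f = z≤n

  𝟙-× : ∀ {P Q : Set} (d : Dec P) (e : Dec Q) → 𝟙 (d ×-dec e) ≡ 𝟙 d * 𝟙 e
  𝟙-× (yes p) (yes q) = refl
  𝟙-× (yes p) (no ¬q) = refl
  𝟙-× (no ¬p) (yes q) = refl
  𝟙-× (no ¬p) (no ¬q) = refl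

  ∑-cong : ∀ (l : List A) {f g : A → ℕ} → (∀ a → f a ≡ g a) → ∑ l f ≡ ∑ l g
  ∑-cong [] e = refl
  ∑-cong (a ∷ l) e = cong₂ _+_ (e a) (∑-cong l e)

  ∑-mono : ∀ (l : List A) {f g : A → ℕ} → (∀ a → f a ≤ g a) → ∑ l f ≤ ∑ l g
  ∑-mono [] e = z≤n
  ∑-mono (a ∷ l) e = +-mono-≤ (e a) (∑-mono l e)

  ∑-+ : ∀ (l : List A) (f g : A → ℕ) → ∑ l (λ a → f a + g a) ≡ ∑ l f + ∑ l g
  ∑-+ [] f g = refl
  ∑-+ (a ∷ l) f g rewrite ∑-+ l f g = interchange (f a) (g a) (∑ l f) (∑ l g)
    where
    interchange : ∀ x y z w → x + y + (z + w) ≡ x + z + (y + w)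
    interchange = solve-∀

  ∑-*ˡ : ∀ (l : List A) (c : ℕ) (f : A → ℕ) → ∑ l (λ a → c * f a) ≡ c * ∑ l f
  ∑-*ˡ [] c f = sym (*-zeroʳ c)
  ∑-*ˡ (a ∷ l) c f rewrite ∑-*ˡ l c f = sym (*-distribˡ-+ c (f a) (∑ l f))

  ∑-*ʳ : ∀ (l : List A) (c : ℕ) (f : A → ℕ) → ∑ l (λ a → f a * c) ≡ ∑ l f * c
  ∑-*ʳ l c f = trans (∑-cong l (λ a → *-comm (f a) c)) (trans (∑-*ˡ l c f) (*-comm c (∑ l f)))

  ∑-const : ∀ (l : List A) (c : ℕ) → ∑ l (λ _ → c) ≡ length l * c
  ∑-const [] c = refl
  ∑-const (a ∷ l) c = cong (c +_) (∑-const l c)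

  ∑-zero : ∀ (l : List A) → ∑ l (λ _ → 0) ≡ 0
  ∑-zero l = trans (∑-const l 0) (*-zeroʳ (length l))

  ∑-swap : ∀ (l : List A) (l' : List B) (f : A → B → ℕ) →
    ∑ l (λ a → ∑ l' (λ b → f a b)) ≡ ∑ l' (λ b → ∑ l (λ a → f a b))
  ∑-swap [] l' f = sym (∑-zero l')
  ∑-swap (a ∷ l) l' f = begin
    ∑ l' (f a) + ∑ l (λ a → ∑ l' (f a)) ≡⟨ cong (∑ l' (f a) +_) (∑-swap l l' f) ⟩
    ∑ l' (f a) + ∑ l' (λ b → ∑ l (λ a → f a b)) ≡⟨ sym (∑-+ l' (f a) (λ b → ∑ l (λ a → f a b))) ⟩
    ∑ l' (λ b → f a b + ∑ l (λ a → f a b)) ∎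
    where open ≡-Reasoning

  ∑*∑ : ∀ (l : List A) (l' : List B) (f : A → ℕ) (h : B → ℕ) →
    ∑ l f * ∑ l' h ≡ ∑ l (λ a → ∑ l' (λ b → f a * h b))
  ∑*∑ l l' f h = trans (sym (∑-*ʳ l (∑ l' h) f)) (∑-cong l (λ a → sym (∑-*ˡ l' (f a) h)))

  ∑-++ : ∀ (l l' : List A) (f : A → ℕ) → ∑ (l ++ l') f ≡ ∑ l f + ∑ l' f
  ∑-++ [] l' f = refl
  ∑-++ (a ∷ l) l' f rewrite ∑-++ l l' f = sym (+-assoc (f a) (∑ l f) (∑ l' f))

  ∑-map : ∀ (l : List A) (g : A → B) (f : B → ℕ) → ∑ (map g l) f ≡ ∑ l (f ∘ g)
  ∑-map [] g f = refl
  ∑-map (a ∷ l) g f = cong (f (g a) +_) (∑-map l g f)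

  ∑-concatMap : ∀ (l : List A) (g : A → List B) (f : B → ℕ) →
    ∑ (concatMap g l) f ≡ ∑ l (λ a → ∑ (g a) f)
  ∑-concatMap [] g f = refl
  ∑-concatMap (a ∷ l) g f = trans (∑-++ (g a) (concatMap g l) f) (cong (∑ (g a) f +_) (∑-concatMap l g f))

  ∑-cartesianProduct : ∀ (l : List A) (l' : List B) (f : A × B → ℕ) →
    ∑ (cartesianProduct l l') f ≡ ∑ l (λ a → ∑ l' (λ b → f (a , b)))
  ∑-cartesianProduct [] l' f = refl
  ∑-cartesianProduct (a ∷ l) l' f = trans (∑-++ (map (a ,_) l') _ f)
    (cong₂ _+_ (∑-map l' (a ,_) f) (∑-cartesianProduct l l' f))

  sum-map≡∑ : ∀ (l : List A) (f : A → ℕ) → sum (map f l) ≡ ∑ l f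
  sum-map≡∑ [] f = refl
  sum-map≡∑ (a ∷ l) f = cong (f a +_) (sum-map≡∑ l f)

  length-filter≡∑𝟙 : ∀ {P : Pred A _} (P? : Decidable P) (l : List A) → length (filter P? l) ≡ ∑ l (λ a → 𝟙 (P? a))
  length-filter≡∑𝟙 P? [] = refl
  length-filter≡∑𝟙 P? (x ∷ l) with P? x
  ... | yes _ = cong suc (length-filter≡∑𝟙 P? l)
  ... | no _ = length-filter≡∑𝟙 P? l

  ∑-filter : ∀ {P : Pred A _} (P? : Decidable P) (l : List A) (f : A → ℕ) →
    ∑ (filter P? l) f ≡ ∑ l (λ a → 𝟙 (P? a) * f a)
  ∑-filter P? [] f = refl
  ∑-filter P? (x ∷ l) f with P? x
  ... | yes _ = cong₂ _+_ (sym (+-identityʳ (f x))) (∑-filter P? l f)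
  ... | no _ = ∑-filter P? l f

  module Enumeration {A : Set} (_≟_ : DecidableEquality A) where

    IsEnum : List A → Set
    IsEnum l = ∀ w → ∑ l (λ c → 𝟙 (c ≟ w)) ≡ 1

    ∑𝟙≟-absent : ∀ {w} (l : List A) → All (w ≢_) l → ∑ l (λ c → 𝟙 (c ≟ w)) ≡ 0
    ∑𝟙≟-absent [] [] = refl
    ∑𝟙≟-absent (c ∷ l) (w≢c ∷ ps) rewrite 𝟙-no (c ≟ _) (w≢c ∘ sym) = ∑𝟙≟-absent l ps

    unique⇒IsEnum : ∀ (l : List A) → Unique l → (∀ w → w ∈ l) → IsEnum l
    unique⇒IsEnum l u complete w = go l u (complete w)
      where
      go : ∀ (l : List A) → Unique l → w ∈ l → ∑ l (λ c → 𝟙 (c ≟ w)) ≡ 1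
      go (x ∷ l) (x∉l ∷ u) (here refl) rewrite 𝟙-yes (x ≟ x) refl = cong suc (∑𝟙≟-absent l x∉l)
      go (x ∷ l) (x∉l ∷ u) (there w∈l) rewrite 𝟙-no (x ≟ w) (All.lookup x∉l w∈l) = go l u w∈l

    𝟙≟-* : ∀ (f : A → ℕ) w c → 𝟙 (c ≟ w) * f c ≡ 𝟙 (c ≟ w) * f w
    𝟙≟-* f w c with c ≟ w
    ... | yes refl = refl
    ... | no _ = refl

    ∑-δ : ∀ l → IsEnum l → ∀ (f : A → ℕ) w → ∑ l (λ c → 𝟙 (c ≟ w) * f c) ≡ f w
    ∑-δ l en f w = begin
      ∑ l (λ c → 𝟙 (c ≟ w) * f c) ≡⟨ ∑-cong l (𝟙≟-* f w) ⟩
      ∑ l (λ c → 𝟙 (c ≟ w) * f w) ≡⟨ ∑-*ʳ l (f w) _ ⟩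
      ∑ l (λ c → 𝟙 (c ≟ w)) * f w ≡⟨ cong (_* f w) (en w) ⟩
      1 * f w ≡⟨ *-identityˡ (f w) ⟩
      f w ∎
      where open ≡-Reasoning

    ∑-fibres : ∀ {C : Set} (l : List A) → IsEnum l → (k : List C) (φ : C → A) (f : C → ℕ) →
      ∑ k f ≡ ∑ l (λ b → ∑ k (λ c → 𝟙 (φ c ≟ b) * f c))
    ∑-fibres l en k φ f = begin
      ∑ k f ≡⟨ ∑-cong k (λ c → sym (∑-δ l en (λ _ → f c) (φ c))) ⟩
      ∑ k (λ c → ∑ l (λ b → 𝟙 (b ≟ φ c) * f c)) ≡⟨ ∑-swap k l _ ⟩
      ∑ l (λ b → ∑ k (λ c → 𝟙 (b ≟ φ c) * f c)) ≡⟨ ∑-cong l (λ b → ∑-cong k (λ c →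
          cong (_* f c) (𝟙-cong (b ≟ φ c) (φ c ≟ b) sym sym))) ⟩
      ∑ l (λ b → ∑ k (λ c → 𝟙 (φ c ≟ b) * f c)) ∎
      where open ≡-Reasoning

    ∑-reindex : ∀ l → IsEnum l → (σ τ : A → A) → (∀ a → τ (σ a) ≡ a) → (∀ b → σ (τ b) ≡ b) →
      ∀ (f : A → ℕ) → ∑ l (f ∘ σ) ≡ ∑ l f
    ∑-reindex l en σ τ τσ στ f = begin
      ∑ l (λ a → f (σ a)) ≡⟨ ∑-fibres l en l σ (λ a → f (σ a)) ⟩
      ∑ l (λ b → ∑ l (λ a → 𝟙 (σ a ≟ b) * f (σ a))) ≡⟨ ∑-cong l (λ b → ∑-cong l (λ a → 𝟙≟-* f b (σ a))) ⟩
      ∑ l (λ b → ∑ l (λ a → 𝟙 (σ a ≟ b) * f b)) ≡⟨ ∑-cong l (λ b → ∑-*ʳ l (f b) _) ⟩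
      ∑ l (λ b → ∑ l (λ a → 𝟙 (σ a ≟ b)) * f b) ≡⟨ ∑-cong l (λ b → cong (_* f b)
          (trans (∑-cong l (λ a → 𝟙-cong (σ a ≟ b) (a ≟ τ b) (λ e → trans (sym (τσ a)) (cong τ e))
                                         (λ e → trans (cong σ e) (στ b)))) (en (τ b)))) ⟩
      ∑ l (λ b → 1 * f b) ≡⟨ ∑-cong l (λ b → *-identityˡ (f b)) ⟩
      ∑ l f ∎
      where open ≡-Reasoning

module Dispersion where

  open import Data.Nat as ℕ using (ℕ)
  open import Data.Integer using (ℤ; +_; -[1+_]; _+_; _*_; -_; _-_; _≤_; +≤+; 0ℤ)
  open import Data.Integer.Properties
  open import Data.Integer.Tactic.RingSolver using (solve-∀)
  open import Data.List using (List; []; _∷_; length)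
  open import Relation.Binary.PropositionalEquality
  open FiniteSums using (∑)

  private variable
    A B : Set

  ∑ℤ : List A → (A → ℤ) → ℤ
  ∑ℤ [] f = 0ℤ
  ∑ℤ (a ∷ l) f = f a + ∑ℤ l f

  ∑ℤ-cong : ∀ (l : List A) {f g : A → ℤ} → (∀ a → f a ≡ g a) → ∑ℤ l f ≡ ∑ℤ l g
  ∑ℤ-cong [] e = refl
  ∑ℤ-cong (a ∷ l) e = cong₂ _+_ (e a) (∑ℤ-cong l e)

  ∑ℤ-mono : ∀ (l : List A) {f g : A → ℤ} → (∀ a → f a ≤ g a) → ∑ℤ l f ≤ ∑ℤ l g
  ∑ℤ-mono [] e = ≤-refl
  ∑ℤ-mono (a ∷ l) e = +-mono-≤ (e a) (∑ℤ-mono l e)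

  ∑ℤ-nonneg : ∀ (l : List A) (f : A → ℤ) → (∀ a → 0ℤ ≤ f a) → 0ℤ ≤ ∑ℤ l f
  ∑ℤ-nonneg [] f h = ≤-refl
  ∑ℤ-nonneg (a ∷ l) f h = +-mono-≤ (h a) (∑ℤ-nonneg l f h)

  ∑ℤ-+ : ∀ (l : List A) (f g : A → ℤ) → ∑ℤ l (λ a → f a + g a) ≡ ∑ℤ l f + ∑ℤ l g
  ∑ℤ-+ [] f g = refl
  ∑ℤ-+ (a ∷ l) f g rewrite ∑ℤ-+ l f g = interchange (f a) (g a) (∑ℤ l f) (∑ℤ l g)
    where
    interchange : ∀ x y z w → x + y + (z + w) ≡ x + z + (y + w)
    interchange = solve-∀

  ∑ℤ-neg : ∀ (l : List A) (f : A → ℤ) → ∑ℤ l (λ a → - f a) ≡ - ∑ℤ l f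
  ∑ℤ-neg [] f = refl
  ∑ℤ-neg (a ∷ l) f rewrite ∑ℤ-neg l f = sym (neg-distrib-+ (f a) (∑ℤ l f))

  ∑ℤ-- : ∀ (l : List A) (f g : A → ℤ) → ∑ℤ l (λ a → f a - g a) ≡ ∑ℤ l f - ∑ℤ l g
  ∑ℤ-- l f g = trans (∑ℤ-+ l f (λ a → - g a)) (cong (_+_ (∑ℤ l f)) (∑ℤ-neg l g))

  ∑ℤ-*ˡ : ∀ (l : List A) (c : ℤ) (f : A → ℤ) → ∑ℤ l (λ a → c * f a) ≡ c * ∑ℤ l f
  ∑ℤ-*ˡ [] c f = sym (*-zeroʳ c)
  ∑ℤ-*ˡ (a ∷ l) c f rewrite ∑ℤ-*ˡ l c f = sym (*-distribˡ-+ c (f a) (∑ℤ l f))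

  ∑ℤ-*ʳ : ∀ (l : List A) (c : ℤ) (f : A → ℤ) → ∑ℤ l (λ a → f a * c) ≡ ∑ℤ l f * c
  ∑ℤ-*ʳ l c f = trans (∑ℤ-cong l (λ a → *-comm (f a) c)) (trans (∑ℤ-*ˡ l c f) (*-comm c (∑ℤ l f)))

  ∑ℤ-const : ∀ (l : List A) (c : ℤ) → ∑ℤ l (λ _ → c) ≡ + length l * c
  ∑ℤ-const [] c = sym (*-zeroˡ c)
  ∑ℤ-const (a ∷ l) c rewrite ∑ℤ-const l c =
    trans (cong (_+ + length l * c) (sym (*-identityˡ c))) (sym (*-distribʳ-+ c (+ 1) (+ length l)))

  ∑ℤ-swap : ∀ (l : List A) (l' : List B) (f : A → B → ℤ) →
    ∑ℤ l (λ a → ∑ℤ l' (λ b → f a b)) ≡ ∑ℤ l' (λ b → ∑ℤ l (λ a → f a b))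
  ∑ℤ-swap [] l' f = sym (trans (∑ℤ-const l' 0ℤ) (*-zeroʳ (+ length l')))
  ∑ℤ-swap (a ∷ l) l' f = trans (cong (_+_ (∑ℤ l' (f a))) (∑ℤ-swap l l' f))
    (sym (∑ℤ-+ l' (f a) (λ b → ∑ℤ l (λ a → f a b))))

  +-∑ : ∀ (l : List A) (f : A → ℕ) → + (∑ l f) ≡ ∑ℤ l (λ a → + f a)
  +-∑ [] f = refl
  +-∑ (a ∷ l) f = trans (pos-+ (f a) (∑ l f)) (cong (_+_ (+ f a)) (+-∑ l f))

  0≤i*i : ∀ i → 0ℤ ≤ i * i
  0≤i*i (+ n) = subst (0ℤ ≤_) (pos-* n n) (+≤+ ℕ.z≤n)
  0≤i*i -[1+ n ] = +≤+ ℕ.z≤n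

  -- n² times the variance of v over T
  dispersion : List A → (A → ℤ) → ℤ
  dispersion T v = + length T * ∑ℤ T (λ t → v t * v t) - ∑ℤ T v * ∑ℤ T v

  lagrange-identity : ∀ (T : List A) (v : A → ℤ) →
    ∑ℤ T (λ t → ∑ℤ T (λ s → (v t - v s) * (v t - v s))) ≡ + 2 * dispersion T v
  lagrange-identity T v = begin
    ∑ℤ T (λ t → ∑ℤ T (λ s → (v t - v s) * (v t - v s)))
      ≡⟨ ∑ℤ-cong T (λ t → ∑ℤ-cong T (λ s → square-- (v t) (v s))) ⟩
    ∑ℤ T (λ t → ∑ℤ T (λ s → v t * v t + v s * v s - + 2 * (v t * v s)))
      ≡⟨ ∑ℤ-cong T inner ⟩
    ∑ℤ T (λ t → + n * (v t * v t) + S2 - + 2 * (v t * S))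
      ≡⟨ trans (∑ℤ-- T _ _) (cong₂ _-_ (trans (∑ℤ-+ T _ _) (cong₂ _+_ (∑ℤ-*ˡ T (+ n) (λ t → v t * v t)) (∑ℤ-const T S2)))
            (trans (∑ℤ-*ˡ T (+ 2) (λ t → v t * S)) (cong (+ 2 *_) (∑ℤ-*ʳ T S v)))) ⟩
    + n * S2 + + n * S2 - + 2 * (S * S) ≡⟨ collect (+ n) S2 S ⟩
    + 2 * (+ n * S2 - S * S) ∎
    where
    open ≡-Reasoning
    n = length T
    S = ∑ℤ T v
    S2 = ∑ℤ T (λ t → v t * v t)
    square-- : ∀ x y → (x - y) * (x - y) ≡ x * x + y * y - + 2 * (x * y)
    square-- = solve-∀
    collect : ∀ a b c → a * b + a * b - + 2 * (c * c) ≡ + 2 * (a * b - c * c)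
    collect = solve-∀
    inner : ∀ t → ∑ℤ T (λ s → v t * v t + v s * v s - + 2 * (v t * v s))
                 ≡ + n * (v t * v t) + S2 - + 2 * (v t * S)
    inner t = trans (∑ℤ-- T _ _) (cong₂ _-_ (trans (∑ℤ-+ T _ _) (cong (_+ S2) (∑ℤ-const T _)))
                (trans (∑ℤ-*ˡ T (+ 2) _) (cong (+ 2 *_) (∑ℤ-*ˡ T (v t) v))))

  cancel-2* : ∀ {i j} → + 2 * i ≤ + 2 * j → i ≤ j
  cancel-2* {i} {j} = *-cancelˡ-≤-pos i j (+ 2)

  0≤dispersion : ∀ (T : List A) (v : A → ℤ) → 0ℤ ≤ dispersion T v
  0≤dispersion T v = cancel-2* (subst₂ _≤_ (sym (*-zeroʳ (+ 2))) (lagrange-identity T v)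
    (∑ℤ-nonneg T _ (λ t → ∑ℤ-nonneg T _ (λ s → 0≤i*i (v t - v s)))))

  cauchy-schwarz : ∀ (T : List A) (v : A → ℤ) → ∑ℤ T v * ∑ℤ T v ≤ + length T * ∑ℤ T (λ t → v t * v t)
  cauchy-schwarz T v = 0≤i-j⇒j≤i (0≤dispersion T v)

  -- Cauchy–Schwarz applied to each difference v t − v s of the column sums v t = Σ_x b x t.
  dispersion-∑≤ : ∀ (T : List A) (X : List B) (b : B → A → ℤ) →
    dispersion T (λ t → ∑ℤ X (λ x → b x t)) ≤ + length X * ∑ℤ X (λ x → dispersion T (b x))
  dispersion-∑≤ T X b = cancel-2* (begin
    + 2 * dispersion T v ≡⟨ sym (lagrange-identity T v) ⟩
    ∑ℤ T (λ t → ∑ℤ T (λ s → (v t - v s) * (v t - v s)))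
      ≡⟨ ∑ℤ-cong T (λ t → ∑ℤ-cong T (λ s → cong (λ z → z * z) (sym (∑ℤ-- X (λ x → b x t) (λ x → b x s))))) ⟩
    ∑ℤ T (λ t → ∑ℤ T (λ s → ∑ℤ X (λ x → b x t - b x s) * ∑ℤ X (λ x → b x t - b x s)))
      ≤⟨ ∑ℤ-mono T (λ t → ∑ℤ-mono T (λ s → cauchy-schwarz X (λ x → b x t - b x s))) ⟩
    ∑ℤ T (λ t → ∑ℤ T (λ s → + m * ∑ℤ X (λ x → (b x t - b x s) * (b x t - b x s))))
      ≡⟨ trans (∑ℤ-cong T (λ t → ∑ℤ-*ˡ T (+ m) _)) (∑ℤ-*ˡ T (+ m) _) ⟩
    + m * ∑ℤ T (λ t → ∑ℤ T (λ s → ∑ℤ X (λ x → (b x t - b x s) * (b x t - b x s))))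
      ≡⟨ cong (+ m *_) (trans (∑ℤ-cong T (λ t → ∑ℤ-swap T X _)) (∑ℤ-swap T X _)) ⟩
    + m * ∑ℤ X (λ x → ∑ℤ T (λ t → ∑ℤ T (λ s → (b x t - b x s) * (b x t - b x s))))
      ≡⟨ cong (+ m *_) (trans (∑ℤ-cong X (λ x → lagrange-identity T (b x))) (∑ℤ-*ˡ X (+ 2) _)) ⟩
    + m * (+ 2 * ∑ℤ X (λ x → dispersion T (b x))) ≡⟨ *-comm-2 (+ m) (∑ℤ X (λ x → dispersion T (b x))) ⟩
    + 2 * (+ m * ∑ℤ X (λ x → dispersion T (b x))) ∎)
    where
    open ≤-Reasoning
    m = length X
    v = λ t → ∑ℤ X (λ x → b x t)
    *-comm-2 : ∀ a c → a * (+ 2 * c) ≡ + 2 * (a * c)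
    *-comm-2 = solve-∀

  dispersion-cong : ∀ (T : List A) {f g : A → ℤ} → (∀ t → f t ≡ g t) → dispersion T f ≡ dispersion T g
  dispersion-cong T f≡g = cong₂ _-_ (cong (+ length T *_) (∑ℤ-cong T (λ t → cong₂ _*_ (f≡g t) (f≡g t))))
    (cong₂ _*_ (∑ℤ-cong T f≡g) (∑ℤ-cong T f≡g))

  dispersionℕ : ∀ (T : List A) (f : A → ℕ) →
    dispersion T (λ t → + f t) ≡ + (length T ℕ.* ∑ T (λ t → f t ℕ.* f t)) - + (∑ T f ℕ.* ∑ T f)
  dispersionℕ T f = cong₂ _-_
    (trans (cong (+ length T *_) (trans (∑ℤ-cong T (λ t → sym (pos-* (f t) (f t)))) (sym (+-∑ T (λ t → f t ℕ.* f t)))))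
           (sym (pos-* (length T) _)))
    (trans (cong₂ _*_ (sym (+-∑ T f)) (sym (+-∑ T f))) (sym (pos-* (∑ T f) (∑ T f))))

  cauchy-schwarzℕ : ∀ (T : List A) (f : A → ℕ) → ∑ T f ℕ.* ∑ T f ℕ.≤ length T ℕ.* ∑ T (λ t → f t ℕ.* f t)
  cauchy-schwarzℕ T f = drop‿+≤+ (0≤i-j⇒j≤i (subst (0ℤ ≤_) (dispersionℕ T f) (0≤dispersion T (λ t → + f t))))

  -- dispersion-∑≤ over ℕ, with both sides moved so that no subtraction occurs
  dispersion-∑≤ℕ : ∀ (T : List A) (X : List B) (b : B → A → ℕ) →
    length T ℕ.* ∑ T (λ t → ∑ X (λ x → b x t) ℕ.* ∑ X (λ x → b x t))
      ℕ.+ length X ℕ.* ∑ X (λ x → ∑ T (b x) ℕ.* ∑ T (b x))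
    ℕ.≤ ∑ T (λ t → ∑ X (λ x → b x t)) ℕ.* ∑ T (λ t → ∑ X (λ x → b x t))
      ℕ.+ length X ℕ.* ∑ X (λ x → length T ℕ.* ∑ T (λ t → b x t ℕ.* b x t))
  dispersion-∑≤ℕ {A} {B} T X b =
    drop‿+≤+ (subst₂ _≤_ lhs≡ rhs≡ (rearrange (+ (n ℕ.* SS)) (+ (Sv ℕ.* Sv)) (+ m) (+ QQ) (+ RR) ineq))
    where
    n = length T
    m = length X
    v : A → ℕ
    v t = ∑ X (λ x → b x t)
    SS = ∑ T (λ t → v t ℕ.* v t)
    Sv = ∑ T v
    RR = ∑ X (λ x → ∑ T (b x) ℕ.* ∑ T (b x))
    QQ = ∑ X (λ x → n ℕ.* ∑ T (λ t → b x t ℕ.* b x t))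
    ∑-dispersion : ∑ℤ X (λ x → dispersion T (λ t → + b x t)) ≡ + QQ - + RR
    ∑-dispersion = trans (∑ℤ-cong X (λ x → dispersionℕ T (b x))) (trans (∑ℤ-- X _ _)
      (cong₂ _-_ (sym (+-∑ X (λ x → n ℕ.* ∑ T (λ t → b x t ℕ.* b x t)))) (sym (+-∑ X (λ x → ∑ T (b x) ℕ.* ∑ T (b x))))))
    ineq : + (n ℕ.* SS) - + (Sv ℕ.* Sv) ≤ + m * (+ QQ - + RR)
    ineq = subst₂ _≤_ (trans (dispersion-cong T (λ t → sym (+-∑ X (λ x → b x t)))) (dispersionℕ T v))
      (cong (+ m *_) ∑-dispersion) (dispersion-∑≤ T X (λ x t → + b x t))
    lhs≡ : + (n ℕ.* SS) + + m * + RR ≡ + (n ℕ.* SS ℕ.+ m ℕ.* RR)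
    lhs≡ = trans (cong (_+_ (+ (n ℕ.* SS))) (sym (pos-* m RR))) (sym (pos-+ (n ℕ.* SS) (m ℕ.* RR)))
    rhs≡ : + (Sv ℕ.* Sv) + + m * + QQ ≡ + (Sv ℕ.* Sv ℕ.+ m ℕ.* QQ)
    rhs≡ = trans (cong (_+_ (+ (Sv ℕ.* Sv))) (sym (pos-* m QQ))) (sym (pos-+ (Sv ℕ.* Sv) (m ℕ.* QQ)))
    rearrange : ∀ a b c d e → a - b ≤ c * (d - e) → a + c * e ≤ b + c * d
    rearrange a b c d e h = subst₂ _≤_ (i1 a b c e) (i2 b c d e) (+-monoˡ-≤ (b + c * e) h)
      where
      i1 : ∀ a b c e → a - b + (b + c * e) ≡ a + c * e
      i1 = solve-∀
      i2 : ∀ b c d e → c * (d - e) + (b + c * e) ≡ b + c * d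
      i2 = solve-∀

module PowerSums where

  open import Data.Nat
  open import Data.Nat.Properties
  open import Data.Nat.Tactic.RingSolver using (solve-∀)
  open import Relation.Binary.PropositionalEquality
  open import Data.Sum using (inj₁; inj₂)

  -- indices run from 1 to n
  ∑₁ : ℕ → (ℕ → ℕ) → ℕ
  ∑₁ zero f = 0
  ∑₁ (suc n) f = ∑₁ n f + f (suc n)

  ∑₁-cong : ∀ n {f g : ℕ → ℕ} → (∀ k → k ≤ n → f k ≡ g k) → ∑₁ n f ≡ ∑₁ n g
  ∑₁-cong zero h = refl
  ∑₁-cong (suc n) h = cong₂ _+_ (∑₁-cong n (λ k k≤n → h k (m≤n⇒m≤1+n k≤n))) (h (suc n) ≤-refl)

  ∑₁-mono : ∀ n {f g : ℕ → ℕ} → (∀ k → k ≤ n → f k ≤ g k) → ∑₁ n f ≤ ∑₁ n g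
  ∑₁-mono zero h = z≤n
  ∑₁-mono (suc n) h = +-mono-≤ (∑₁-mono n (λ k k≤n → h k (m≤n⇒m≤1+n k≤n))) (h (suc n) ≤-refl)

  ∑₁-*ˡ : ∀ n c (f : ℕ → ℕ) → ∑₁ n (λ k → c * f k) ≡ c * ∑₁ n f
  ∑₁-*ˡ zero c f = sym (*-zeroʳ c)
  ∑₁-*ˡ (suc n) c f rewrite ∑₁-*ˡ n c f = sym (*-distribˡ-+ c (∑₁ n f) (f (suc n)))

  ∑₁-monoˡ : ∀ {m n} (f : ℕ → ℕ) → m ≤ n → ∑₁ m f ≤ ∑₁ n f
  ∑₁-monoˡ {m} {zero} f z≤n = z≤n
  ∑₁-monoˡ {m} {suc n} f m≤1+n with m≤n⇒m<n∨m≡n m≤1+n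
  ... | inj₁ m<1+n = ≤-trans (∑₁-monoˡ f (≤-pred m<1+n)) (m≤m+n (∑₁ n f) (f (suc n)))
  ... | inj₂ refl = ≤-refl

  -- stated with q = suc Q so that no subtraction occurs
  geometric-sum : ∀ Q j → 1 + Q * ∑₁ j (λ k → suc Q ^ (k ∸ 1)) ≡ suc Q ^ j
  geometric-sum Q zero = cong suc (*-zeroʳ Q)
  geometric-sum Q (suc j) = begin
    1 + Q * (∑₁ j g + suc Q ^ j) ≡⟨ distrib Q (∑₁ j g) (suc Q ^ j) ⟩
    (1 + Q * ∑₁ j g) + Q * suc Q ^ j ≡⟨ cong (_+ Q * suc Q ^ j) (geometric-sum Q j) ⟩
    suc Q * suc Q ^ j ∎
    where
    open ≡-Reasoning
    g = λ k → suc Q ^ (k ∸ 1)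
    distrib : ∀ Q a b → 1 + Q * (a + b) ≡ (1 + Q * a) + Q * b
    distrib = solve-∀

  -- = (Y^n − q^n) / (Y − q)
  mixedPowerSum : ℕ → ℕ → ℕ → ℕ
  mixedPowerSum q Y n = ∑₁ n (λ k → q ^ (k ∸ 1) * Y ^ (n ∸ k))

  mixedPowerSum-suc : ∀ q Y n → mixedPowerSum q Y (suc n) ≡ Y * mixedPowerSum q Y n + q ^ n
  mixedPowerSum-suc q Y n = begin
    ∑₁ n (λ k → q ^ (k ∸ 1) * Y ^ (suc n ∸ k)) + q ^ n * Y ^ (n ∸ n)
      ≡⟨ cong₂ _+_ (∑₁-cong n (λ k k≤n → cong (λ e → q ^ (k ∸ 1) * Y ^ e) (+-∸-assoc 1 k≤n)))
                   (cong (λ e → q ^ n * Y ^ e) (n∸n≡0 n)) ⟩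
    ∑₁ n (λ k → q ^ (k ∸ 1) * (Y * Y ^ (n ∸ k))) + q ^ n * 1
      ≡⟨ cong₂ _+_ (trans (∑₁-cong n (λ k _ → swap (q ^ (k ∸ 1)) Y (Y ^ (n ∸ k)))) (∑₁-*ˡ n Y _)) (*-identityʳ _) ⟩
    Y * mixedPowerSum q Y n + q ^ n ∎
    where
    open ≡-Reasoning
    swap : ∀ a b c → a * (b * c) ≡ b * (a * c)
    swap = solve-∀

  -- (Y − q) · mixedPowerSum q Y n = Y^n − q^n, with q = suc Q and Y = q (1 + t)
  mixedPowerSum-difference : ∀ Q t n →
    t * suc Q * mixedPowerSum (suc Q) (suc Q * suc t) n + suc Q ^ n ≡ (suc Q * suc t) ^ n
  mixedPowerSum-difference Q t zero = cong (_+ 1) (*-zeroʳ (t * suc Q))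
  mixedPowerSum-difference Q t (suc n) = begin
    t * q * S (suc n) + q ^ suc n ≡⟨ cong (λ z → t * q * z + q ^ suc n) (mixedPowerSum-suc q Y n) ⟩
    t * q * (Y * S n + q ^ n) + q * q ^ n ≡⟨ regroup Q t (S n) (q ^ n) ⟩
    Y * (t * q * S n + q ^ n) ≡⟨ cong (Y *_) (mixedPowerSum-difference Q t n) ⟩
    Y * Y ^ n ∎
    where
    open ≡-Reasoning
    q = suc Q
    Y = suc Q * suc t
    S = mixedPowerSum q Y
    regroup : ∀ Q t T p → t * suc Q * (suc Q * suc t * T + p) + suc Q * p ≡ suc Q * suc t * (t * suc Q * T + p)
    regroup = solve-∀

  ^-distribʳ-* : ∀ m n o → (m * n) ^ o ≡ m ^ o * n ^ o
  ^-distribʳ-* m n zero = refl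
  ^-distribʳ-* m n (suc o) rewrite ^-distribʳ-* m n o = interchange m n (m ^ o) (n ^ o)
    where
    interchange : ∀ a b c e → a * b * (c * e) ≡ a * c * (b * e)
    interchange = solve-∀

  ^-comm : ∀ m n o → (m ^ n) ^ o ≡ (m ^ o) ^ n
  ^-comm m n o = trans (^-*-assoc m n o) (trans (cong (m ^_) (*-comm n o)) (sym (^-*-assoc m o n)))

module ChainRing (R : FiniteChainRing) where

  open import Level using (0ℓ)
  open import Algebra.Bundles using (CommutativeRing)
  import Algebra.Properties.Ring
  import Algebra.Properties.CommutativeSemigroup
  open import Algebra.Structures using (IsCommutativeRing)
  open import Data.Nat using (ℕ; zero; suc)
  open import Data.Product using (Σ; ∃; _×_; _,_; proj₁; proj₂)
  open import Data.Sum using (_⊎_; inj₁; inj₂)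
  open import Data.Empty using (⊥-elim)
  open import Data.List using (List; []; _∷_)
  open import Data.List.Membership.Propositional using (_∈_; find; lose)
  open import Data.List.Relation.Unary.Any using (here; there; any?)
  open import Relation.Nullary using (Dec; yes; no)
  open import Relation.Nullary.Decidable using (map′)
  open import Relation.Unary using (Pred; Decidable)
  open import Relation.Binary.PropositionalEquality

  open FCR R public

  commutativeRing : CommutativeRing 0ℓ 0ℓ
  commutativeRing = record { isCommutativeRing = isCommutativeRing }

  open IsCommutativeRing isCommutativeRing public
    using (+-assoc; +-comm; +-identityˡ; +-identityʳ; -‿inverseʳ;
           *-assoc; *-comm; *-identityˡ; *-identityʳ; zeroˡ; zeroʳ; distribˡ)
  open Algebra.Properties.Ring (CommutativeRing.ring commutativeRing) public
    using (-‿distribˡ-*; -‿distribʳ-*; -‿+-comm; -‿involutive)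
  open Algebra.Properties.CommutativeSemigroup (CommutativeRing.*-commutativeSemigroup commutativeRing) public
    using (x∙yz≈y∙xz) renaming (interchange to *-interchange)
  open Algebra.Properties.CommutativeSemigroup (CommutativeRing.+-commutativeSemigroup commutativeRing) public
    using () renaming (interchange to +-interchange)

  -- the field _≟_ has no fixity declaration
  infix 4 _≟'_
  _≟'_ : (a b : Carrier) → Dec (a ≡ b)
  a ≟' b = a ≟ b

  infixl 6 _-_
  _-_ : Carrier → Carrier → Carrier
  a - b = a + - b

  x-y+y≡x : ∀ x y → x - y + y ≡ x
  x-y+y≡x x y = trans (+-assoc x (- y) y) (trans (cong (x +_) (trans (+-comm (- y) y) (-‿inverseʳ y))) (+-identityʳ x))

  x+y-y≡x : ∀ x y → x + y - y ≡ x
  x+y-y≡x x y = trans (+-assoc x y (- y)) (trans (cong (x +_) (-‿inverseʳ y)) (+-identityʳ x))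

  x+y≡y⇒x≡0 : ∀ {x y} → x + y ≡ y → x ≡ 0#
  x+y≡y⇒x≡0 {x} {y} e = trans (sym (x+y-y≡x x y)) (trans (cong (_- y) e) (-‿inverseʳ y))

  x-y≡0⇒x≡y : ∀ {x y} → x - y ≡ 0# → x ≡ y
  x-y≡0⇒x≡y {x} {y} e = trans (sym (x-y+y≡x x y)) (trans (cong (_+ y) e) (+-identityˡ y))

  x≡y⇒x-y≡0 : ∀ {x y} → x ≡ y → x - y ≡ 0#
  x≡y⇒x-y≡0 {x} refl = -‿inverseʳ x

  ∃? : ∀ {P : Pred Carrier 0ℓ} → Decidable P → Dec (∃ P)
  ∃? P? = map′ (λ p → let (x , _ , px) = find p in x , px) (λ (x , px) → lose (complete x) px) (any? P? elems)

  isUnit-* : ∀ {a b} → IsUnit a → IsUnit b → IsUnit (a * b)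
  isUnit-* {a} {b} (a' , aa'≡1) (b' , bb'≡1) = a' * b' , (begin
    a * b * (a' * b') ≡⟨ *-interchange a b a' b' ⟩
    a * a' * (b * b') ≡⟨ cong₂ _*_ aa'≡1 bb'≡1 ⟩
    1# * 1# ≡⟨ *-identityʳ 1# ⟩
    1# ∎)
    where open ≡-Reasoning

  isUnit-*⁻ˡ : ∀ {a b} → IsUnit (a * b) → IsUnit a
  isUnit-*⁻ˡ {a} {b} (y , e) = b * y , trans (sym (*-assoc a b y)) e

  isUnit-inverse : ∀ {a} → (u : IsUnit a) → IsUnit (proj₁ u)
  isUnit-inverse {a} (y , e) = a , trans (*-comm y a) e

  unit*x≡0⇒x≡0 : ∀ {u x} → IsUnit u → u * x ≡ 0# → x ≡ 0#
  unit*x≡0⇒x≡0 {u} {x} (v , uv≡1) ux≡0 = begin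
    x ≡⟨ sym (*-identityˡ x) ⟩
    1# * x ≡⟨ cong (_* x) (sym (trans (*-comm v u) uv≡1)) ⟩
    v * u * x ≡⟨ *-assoc v u x ⟩
    v * (u * x) ≡⟨ cong (v *_) ux≡0 ⟩
    v * 0# ≡⟨ zeroʳ v ⟩
    0# ∎
    where open ≡-Reasoning

  nonUnit-*ˡ : ∀ c {x} → NonUnit x → NonUnit (c * x)
  nonUnit-*ˡ c {x} nx u = nx (isUnit-*⁻ˡ (subst IsUnit (*-comm c x) u))

  nonUnit-*ʳ : ∀ c {x} → NonUnit x → NonUnit (x * c)
  nonUnit-*ʳ c {x} nx = subst NonUnit (*-comm c x) (nonUnit-*ˡ c nx)

  nonUnit-0 : NonUnit 0#
  nonUnit-0 (y , e) = 1≢0 (trans (sym e) (zeroˡ y))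

  nonUnit-neg : ∀ {x} → NonUnit x → NonUnit (- x)
  nonUnit-neg {x} nx (y , e) = nx (- y , trans (trans (sym (-‿distribʳ-* x y)) (-‿distribˡ-* x y)) e)

  nonUnit-- : ∀ {x y} → NonUnit x → NonUnit y → NonUnit (x - y)
  nonUnit-- nx ny = local nx (nonUnit-neg ny)

  infix 4 _∣_ _∣?_
  _∣_ : Carrier → Carrier → Set
  a ∣ b = ∃ λ c → b ≡ a * c

  _∣?_ : ∀ a → Decidable (a ∣_)
  a ∣? b = ∃? (λ c → b ≟ (a * c))

  principalIdeal : Carrier → Ideal _+_ _*_ 0#
  principalIdeal a = record
    { member = a ∣_
    ; 0∈ = 0# , sym (zeroʳ a)
    ; +-closed = λ { (c , refl) (c' , refl) → c + c' , sym (distribˡ a c c') }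
    ; *-closed = λ { r (c , refl) → r * c , x∙yz≈y∙xz r a c }
    }

  ∣-refl : ∀ a → a ∣ a
  ∣-refl a = 1# , sym (*-identityʳ a)

  ∣-trans : ∀ {a b c} → a ∣ b → b ∣ c → a ∣ c
  ∣-trans {a} (s , refl) (t , refl) = s * t , *-assoc a s t

  ∣-total : ∀ a b → b ∣ a ⊎ a ∣ b
  ∣-total a b with chain (principalIdeal a) (principalIdeal b)
  ... | inj₁ Ra⊆Rb = inj₁ (Ra⊆Rb a (∣-refl a))
  ... | inj₂ Rb⊆Ra = inj₂ (Rb⊆Ra b (∣-refl b))

  nonUnit-∣ : ∀ {a b} → NonUnit a → a ∣ b → NonUnit b
  nonUnit-∣ {a} na (c , refl) = nonUnit-*ʳ c na

  -- Since the principal ideals form a chain, the non-unit generating the largest one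
  -- among those of the listed non-units divides them all.
  private
    generator : (l : List Carrier) → Σ Carrier λ p → NonUnit p × (∀ b → b ∈ l → NonUnit b → p ∣ b)
    generator [] = 0# , nonUnit-0 , λ b ()
    generator (x ∷ l) with generator l | nonUnit? x
    ... | p , np , hp | no ¬nx = p , np , λ { b (here refl) nb → ⊥-elim (¬nx nb) ; b (there m) nb → hp b m nb }
    ... | p , np , hp | yes nx with ∣-total p x
    ...   | inj₁ x∣p = x , nx , λ { b (here refl) nb → ∣-refl b ; b (there m) nb → ∣-trans x∣p (hp b m nb) }
    ...   | inj₂ p∣x = p , np , λ { b (here refl) nb → p∣x ; b (there m) nb → hp b m nb }

  π : Carrier
  π = proj₁ (generator elems)

  nonUnit-π : NonUnit π
  nonUnit-π = proj₁ (proj₂ (generator elems))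

  nonUnit⇒π∣ : ∀ b → NonUnit b → π ∣ b
  nonUnit⇒π∣ b nb = proj₂ (proj₂ (generator elems)) b (complete b) nb

  π∣⇒nonUnit : ∀ b → π ∣ b → NonUnit b
  π∣⇒nonUnit b = nonUnit-∣ nonUnit-π

  infix 10 π^_
  π^_ : ℕ → Carrier
  π^ zero = 1#
  π^ suc j = π * π^ j

module Annihilators (R : FiniteChainRing) where

  open import Data.Nat as ℕ using (ℕ; suc; _≤_)
  import Data.Nat.Properties as NP
  open import Data.Product using (_,_)
  open import Data.List using (length)
  open import Relation.Nullary using (yes; no)
  open import Relation.Binary.PropositionalEquality
  open FiniteSums
  open ChainRing R public

  open Enumeration _≟_ public

  elems-isEnum : IsEnum elems
  elems-isEnum = unique⇒IsEnum elems unique complete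

  card≡∑1 : card ≡ ∑ elems (λ _ → 1)
  card≡∑1 = sym (trans (∑-const elems 1) (NP.*-identityʳ (length elems)))

  cardNonUnits≡∑𝟙 : cardNonUnits ≡ ∑ elems (λ b → 𝟙 (nonUnit? b))
  cardNonUnits≡∑𝟙 = length-filter≡∑𝟙 nonUnit? elems

  #units : ℕ
  #units = ∑ elems (λ u → 𝟙 (isUnit? u))

  #units+cardNonUnits≡card : #units ℕ.+ cardNonUnits ≡ card
  #units+cardNonUnits≡card = trans (cong (#units ℕ.+_) cardNonUnits≡∑𝟙)
    (trans (sym (∑-+ elems _ _)) (trans (∑-cong elems unit+nonUnit) (sym card≡∑1)))
    where
    unit+nonUnit : ∀ u → 𝟙 (isUnit? u) ℕ.+ 𝟙 (nonUnit? u) ≡ 1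
    unit+nonUnit u with isUnit? u
    ... | yes _ = refl
    ... | no _ = refl

  #ann : Carrier → ℕ
  #ann c = ∑ elems (λ a → 𝟙 (c * a ≟' 0#))

  #ideal : Carrier → ℕ
  #ideal c = ∑ elems (λ b → 𝟙 (c ∣? b))

  ∑-translate : ∀ (c : Carrier) (f : Carrier → ℕ) → ∑ elems (λ a → f (a + c)) ≡ ∑ elems f
  ∑-translate c = ∑-reindex elems elems-isEnum (_+ c) (_- c) (λ a → x+y-y≡x a c) (λ a → x-y+y≡x a c)

  ∑𝟙[c*a≡b] : ∀ c b → ∑ elems (λ a → 𝟙 (c * a ≟' b)) ≡ 𝟙 (c ∣? b) ℕ.* #ann c
  ∑𝟙[c*a≡b] c b with c ∣? b
  ... | no c∤b = trans (∑-cong elems (λ a → 𝟙-no (c * a ≟' b) (λ e → c∤b (a , sym e)))) (∑-zero elems)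
  ... | yes (a₀ , b≡ca₀) = begin
    ∑ elems (λ a → 𝟙 (c * a ≟' b)) ≡⟨ sym (∑-translate a₀ (λ a → 𝟙 (c * a ≟' b))) ⟩
    ∑ elems (λ a → 𝟙 (c * (a + a₀) ≟' b)) ≡⟨ ∑-cong elems (λ a → 𝟙-cong (c * (a + a₀) ≟' b) (c * a ≟' 0#)
         (λ h → x+y≡y⇒x≡0 (trans (sym (trans (distribˡ c a a₀) (cong (c * a +_) (sym b≡ca₀)))) h))
         (λ h → trans (distribˡ c a a₀) (trans (cong₂ _+_ h (sym b≡ca₀)) (+-identityˡ b)))) ⟩
    #ann c ≡⟨ sym (NP.*-identityˡ (#ann c)) ⟩
    1 ℕ.* #ann c ∎
    where open ≡-Reasoning

  card≡#ideal*#ann : ∀ c → card ≡ #ideal c ℕ.* #ann c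
  card≡#ideal*#ann c = begin
    card ≡⟨ card≡∑1 ⟩
    ∑ elems (λ _ → 1) ≡⟨ ∑-fibres elems elems-isEnum elems (c *_) (λ _ → 1) ⟩
    ∑ elems (λ b → ∑ elems (λ a → 𝟙 (c * a ≟' b) ℕ.* 1))
      ≡⟨ ∑-cong elems (λ b → trans (∑-cong elems (λ a → NP.*-identityʳ _)) (∑𝟙[c*a≡b] c b)) ⟩
    ∑ elems (λ b → 𝟙 (c ∣? b) ℕ.* #ann c) ≡⟨ ∑-*ʳ elems (#ann c) _ ⟩
    #ideal c ℕ.* #ann c ∎
    where open ≡-Reasoning

  #ideal-π≡cardNonUnits : #ideal π ≡ cardNonUnits
  #ideal-π≡cardNonUnits = trans (∑-cong elems (λ b → 𝟙-cong (π ∣? b) (nonUnit? b) (π∣⇒nonUnit b) (nonUnit⇒π∣ b)))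
    (sym cardNonUnits≡∑𝟙)

  card≡cardNonUnits*#ann-π : card ≡ cardNonUnits ℕ.* #ann π
  card≡cardNonUnits*#ann-π = trans (card≡#ideal*#ann π) (cong (ℕ._* #ann π) #ideal-π≡cardNonUnits)

  1≤cardNonUnits : 1 ≤ cardNonUnits
  1≤cardNonUnits = subst (1 ≤_) (sym cardNonUnits≡∑𝟙) (subst (_≤ ∑ elems (λ b → 𝟙 (nonUnit? b))) (elems-isEnum 0#)
    (∑-mono elems (λ b → 𝟙-mono (b ≟' 0#) (nonUnit? b) (λ { refl → nonUnit-0 }))))

  -- a ↦ π a covers every b killed by π^j exactly #ann π times, because such b lie in πR
  #ann-π^suc : ∀ j → π^ j ≢ 0# → #ann (π^ suc j) ≡ #ann (π^ j) ℕ.* #ann π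
  #ann-π^suc j π^j≢0 = begin
    ∑ elems (λ a → 𝟙 (π * π^ j * a ≟' 0#)) ≡⟨ ∑-cong elems (λ a → 𝟙-cong (π * π^ j * a ≟' 0#) (π^ j * (π * a) ≟' 0#)
        (trans (sym (reassoc a))) (trans (reassoc a))) ⟩
    ∑ elems (λ a → f (π * a)) ≡⟨ ∑-fibres elems elems-isEnum elems (π *_) (λ a → f (π * a)) ⟩
    ∑ elems (λ b → ∑ elems (λ a → 𝟙 (π * a ≟' b) ℕ.* f (π * a)))
      ≡⟨ ∑-cong elems (λ b → ∑-cong elems (λ a → 𝟙≟-* f b (π * a))) ⟩
    ∑ elems (λ b → ∑ elems (λ a → 𝟙 (π * a ≟' b) ℕ.* f b))
      ≡⟨ ∑-cong elems (λ b → trans (∑-*ʳ elems (f b) _) (cong (ℕ._* f b) (∑𝟙[c*a≡b] π b))) ⟩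
    ∑ elems (λ b → 𝟙 (π ∣? b) ℕ.* #ann π ℕ.* f b) ≡⟨ ∑-cong elems killed-by-π^j⇒π∣ ⟩
    ∑ elems (λ b → f b ℕ.* #ann π) ≡⟨ ∑-*ʳ elems (#ann π) f ⟩
    #ann (π^ j) ℕ.* #ann π ∎
    where
    open ≡-Reasoning
    f : Carrier → ℕ
    f b = 𝟙 (π^ j * b ≟' 0#)
    reassoc : ∀ a → π * π^ j * a ≡ π^ j * (π * a)
    reassoc a = trans (cong (_* a) (*-comm π (π^ j))) (*-assoc (π^ j) π a)
    killed-by-π^j⇒π∣ : ∀ b → 𝟙 (π ∣? b) ℕ.* #ann π ℕ.* f b ≡ f b ℕ.* #ann π
    killed-by-π^j⇒π∣ b with π^ j * b ≟' 0#
    ... | no _ = NP.*-zeroʳ (𝟙 (π ∣? b) ℕ.* #ann π)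
    ... | yes π^jb≡0 rewrite 𝟙-yes (π ∣? b) (nonUnit⇒π∣ b (λ u →
            π^j≢0 (unit*x≡0⇒x≡0 u (trans (*-comm b (π^ j)) π^jb≡0)))) = NP.*-identityʳ (1 ℕ.* #ann π)

  #ann-1 : #ann 1# ≡ 1
  #ann-1 = trans (∑-cong elems (λ a → cong (λ z → 𝟙 (z ≟' 0#)) (*-identityˡ a))) (elems-isEnum 0#)

  #ann≤card : ∀ c → #ann c ≤ card
  #ann≤card c = subst (#ann c ≤_) (sym card≡∑1) (∑-mono elems (λ a → 𝟙≤1 (c * a ≟' 0#)))

  #ann-0 : #ann 0# ≡ card
  #ann-0 = trans (∑-cong elems (λ a → 𝟙-yes (0# * a ≟' 0#) (zeroˡ a))) (sym card≡∑1)

module ChainRingSize (R : FiniteChainRing) (q' r : Data.Nat.ℕ)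
  (card≡q^r : FCR.card R PEq.≡ (2 Data.Nat.+ q') Data.Nat.^ r)
  (card≡q*cardNonUnits : FCR.card R PEq.≡ (2 Data.Nat.+ q') Data.Nat.* FCR.cardNonUnits R) where

  open import Data.Nat as ℕ using (ℕ; zero; suc; _≤_; _<_; z≤n; s≤s; _^_)
  import Data.Nat.Properties as NP
  open import Data.Empty using (⊥-elim)
  open import Data.Sum using (inj₁; inj₂)
  open import Relation.Nullary using (yes; no)
  open import Relation.Binary.PropositionalEquality
  open Annihilators R public

  q : ℕ
  q = 2 ℕ.+ q'

  1<q : 1 < q
  1<q = s≤s (s≤s z≤n)

  instance
    cardNonUnits≢0 : ℕ.NonZero cardNonUnits
    cardNonUnits≢0 = ℕ.≢-nonZero (λ e → NP.<⇒≢ 1≤cardNonUnits (sym e))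

  #ann-π≡q : #ann π ≡ q
  #ann-π≡q = NP.*-cancelˡ-≡ (#ann π) q cardNonUnits
    (trans (sym card≡cardNonUnits*#ann-π) (trans card≡q*cardNonUnits (NP.*-comm q cardNonUnits)))

  #ann-π^≡q^ : ∀ j → (∀ i → i < j → π^ i ≢ 0#) → #ann (π^ j) ≡ q ^ j
  #ann-π^≡q^ zero _ = #ann-1
  #ann-π^≡q^ (suc j) π^i≢0 = trans (#ann-π^suc j (π^i≢0 j NP.≤-refl))
    (trans (cong₂ ℕ._*_ (#ann-π^≡q^ j (λ i i<j → π^i≢0 i (NP.m<n⇒m<1+n i<j))) #ann-π≡q) (NP.*-comm (q ^ j) q))

  -- π^i = 0 with i < r would make #ann (π^i) both |R| = q^r and q^i
  π^i≢0-below : ∀ n → n ≤ r → ∀ i → i < n → π^ i ≢ 0#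
  π^i≢0-below (suc n) 1+n≤r i i<1+n π^i≡0 with NP.m≤n⇒m<n∨m≡n (NP.≤-pred i<1+n)
  ... | inj₁ i<n = π^i≢0-below n (NP.≤-trans (NP.n≤1+n n) 1+n≤r) i i<n π^i≡0
  ... | inj₂ refl = NP.<⇒≢ (NP.^-monoʳ-< q 1<q 1+n≤r)
        (trans (sym (#ann-π^≡q^ i (π^i≢0-below i (NP.≤-trans (NP.n≤1+n i) 1+n≤r))))
               (trans (cong #ann π^i≡0) (trans #ann-0 card≡q^r)))

  π^i≢0 : ∀ i → i < r → π^ i ≢ 0#
  π^i≢0 = π^i≢0-below r NP.≤-refl

  #ann-π^j≡q^j : ∀ j → j ≤ r → #ann (π^ j) ≡ q ^ j
  #ann-π^j≡q^j j j≤r = #ann-π^≡q^ j (λ i i<j → π^i≢0 i (NP.<-≤-trans i<j j≤r))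

  -- otherwise #ann (π^(r+1)) = q^(r+1) would exceed |R|
  π^r≡0 : π^ r ≡ 0#
  π^r≡0 with π^ r ≟' 0#
  ... | yes π^r≡0 = π^r≡0
  ... | no π^r≢0 = ⊥-elim (NP.<⇒≱ (NP.^-monoʳ-< q 1<q (NP.n<1+n r))
          (subst (_≤ q ^ r) (#ann-π^≡q^ (suc r) below) (subst (#ann (π^ suc r) ≤_) card≡q^r (#ann≤card (π^ suc r)))))
    where
    below : ∀ i → i < suc r → π^ i ≢ 0#
    below i i<1+r with NP.m≤n⇒m<n∨m≡n (NP.≤-pred i<1+r)
    ... | inj₁ i<r = π^i≢0 i i<r
    ... | inj₂ refl = π^r≢0

  #ideal-π^k*q^k≡q^r : ∀ k → k ≤ r → #ideal (π^ k) ℕ.* q ^ k ≡ q ^ r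
  #ideal-π^k*q^k≡q^r k k≤r = trans (cong (#ideal (π^ k) ℕ.*_) (sym (#ann-π^j≡q^j k k≤r)))
    (trans (sym (card≡#ideal*#ann (π^ k))) card≡q^r)

  r≢0 : r ≢ 0
  r≢0 refl = NP.<⇒≢ (NP.≤-trans 1<q (NP.m≤m*n q cardNonUnits)) (sym (trans (sym card≡q*cardNonUnits) card≡q^r))

  π^j*b≡0⇒nonUnit : ∀ j → j < r → ∀ b → π^ j * b ≡ 0# → NonUnit b
  π^j*b≡0⇒nonUnit j j<r b π^jb≡0 u = π^i≢0 j j<r (unit*x≡0⇒x≡0 u (trans (*-comm b (π^ j)) π^jb≡0))

module Vectors (R : FiniteChainRing) where

  open import Level using (0ℓ)
  open import Data.Nat as ℕ using (ℕ; zero; suc; _^_)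
  import Data.Nat.Properties as NP
  open import Data.Product using (_,_)
  open import Data.Empty using (⊥-elim)
  open import Data.List using (map)
  open import Data.List.Membership.Propositional using (_∈_)
  open import Data.List.Membership.Propositional.Properties using (∈-map⁺)
  import Data.List.Relation.Unary.Any as Any
  open import Data.List.Relation.Unary.Any.Properties using (concatMap⁺)
  open import Data.Vec using (Vec; []; _∷_)
  import Data.Vec as Vec
  import Data.Vec.Properties as VecP
  open import Data.Vec.Relation.Unary.All as VAll using ([]; _∷_)
  open import Data.Vec.Relation.Unary.Any as VAny using (here; there)
  open import Relation.Nullary using (¬_; yes; no)
  open import Relation.Nullary.Decidable using (_×-dec_; ¬?)
  open import Relation.Unary using (Pred; Decidable)
  open import Relation.Binary.PropositionalEquality
  open FiniteSums
  open Annihilators R public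

  module VecEnumeration {d : ℕ} = Enumeration (_≟ᵛ_ {d})

  ∑-allVec-suc : ∀ {d} (f : Vec Carrier (suc d) → ℕ) → ∑ (allVec (suc d)) f ≡ ∑ elems (λ a → ∑ (allVec d) (λ x → f (a ∷ x)))
  ∑-allVec-suc {d} f = trans (∑-concatMap elems (λ a → map (a ∷_) (allVec d)) f)
    (∑-cong elems (λ a → ∑-map (allVec d) (a ∷_) f))

  ∈-allVec : ∀ {d} (x : Vec Carrier d) → x ∈ allVec d
  ∈-allVec [] = Any.here refl
  ∈-allVec (a ∷ x) = concatMap⁺ _ (Any.map (λ { refl → ∈-map⁺ (a ∷_) (∈-allVec x) }) (complete a))

  𝟙-∷-≟ : ∀ {d} a b (x w : Vec Carrier d) → 𝟙 ((a ∷ x) ≟ᵛ (b ∷ w)) ≡ 𝟙 (a ≟ b) ℕ.* 𝟙 (x ≟ᵛ w)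
  𝟙-∷-≟ a b x w = trans (𝟙-cong ((a ∷ x) ≟ᵛ (b ∷ w)) ((a ≟ b) ×-dec (x ≟ᵛ w))
     (λ { refl → refl , refl }) (λ { (refl , refl) → refl })) (𝟙-× (a ≟ b) (x ≟ᵛ w))

  allVec-isEnum : ∀ d → VecEnumeration.IsEnum {d} (allVec d)
  allVec-isEnum zero [] = refl
  allVec-isEnum (suc d) (b ∷ w) = begin
    ∑ (allVec (suc d)) (λ c → 𝟙 (c ≟ᵛ (b ∷ w))) ≡⟨ ∑-allVec-suc _ ⟩
    ∑ elems (λ a → ∑ (allVec d) (λ x → 𝟙 ((a ∷ x) ≟ᵛ (b ∷ w))))
      ≡⟨ ∑-cong elems (λ a → trans (∑-cong (allVec d) (λ x → 𝟙-∷-≟ a b x w)) (∑-*ˡ (allVec d) (𝟙 (a ≟ b)) _)) ⟩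
    ∑ elems (λ a → 𝟙 (a ≟ b) ℕ.* ∑ (allVec d) (λ x → 𝟙 (x ≟ᵛ w)))
      ≡⟨ ∑-cong elems (λ a → trans (cong (𝟙 (a ≟ b) ℕ.*_) (allVec-isEnum d w)) (NP.*-identityʳ _)) ⟩
    ∑ elems (λ a → 𝟙 (a ≟ b)) ≡⟨ elems-isEnum b ⟩
    1 ∎
    where open ≡-Reasoning

  𝟙-all?-∷ : ∀ {P : Pred Carrier 0ℓ} (P? : Decidable P) {d} a (x : Vec Carrier d) →
    𝟙 (VAll.all? P? (a ∷ x)) ≡ 𝟙 (P? a) ℕ.* 𝟙 (VAll.all? P? x)
  𝟙-all?-∷ P? a x = trans (𝟙-cong (VAll.all? P? (a ∷ x)) (P? a ×-dec VAll.all? P? x)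
    (λ { (p ∷ ps) → p , ps }) (λ { (p , ps) → p ∷ ps })) (𝟙-× (P? a) (VAll.all? P? x))

  #All≡#^d : ∀ {P : Pred Carrier 0ℓ} (P? : Decidable P) d →
    ∑ (allVec d) (λ x → 𝟙 (VAll.all? P? x)) ≡ ∑ elems (λ a → 𝟙 (P? a)) ^ d
  #All≡#^d P? zero = refl
  #All≡#^d P? (suc d) = begin
    ∑ (allVec (suc d)) (λ x → 𝟙 (VAll.all? P? x)) ≡⟨ ∑-allVec-suc _ ⟩
    ∑ elems (λ a → ∑ (allVec d) (λ x → 𝟙 (VAll.all? P? (a ∷ x))))
      ≡⟨ ∑-cong elems (λ a → trans (∑-cong (allVec d) (𝟙-all?-∷ P? a)) (∑-*ˡ (allVec d) (𝟙 (P? a)) _)) ⟩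
    ∑ elems (λ a → 𝟙 (P? a) ℕ.* ∑ (allVec d) (λ x → 𝟙 (VAll.all? P? x))) ≡⟨ ∑-*ʳ elems _ _ ⟩
    ∑ elems (λ a → 𝟙 (P? a)) ℕ.* ∑ (allVec d) (λ x → 𝟙 (VAll.all? P? x)) ≡⟨ cong (∑ elems (λ a → 𝟙 (P? a)) ℕ.*_) (#All≡#^d P? d) ⟩
    ∑ elems (λ a → 𝟙 (P? a)) ℕ.* ∑ elems (λ a → 𝟙 (P? a)) ^ d ∎
    where open ≡-Reasoning

  ∑-allVec-1 : ∀ d → ∑ (allVec d) (λ _ → 1) ≡ card ^ d
  ∑-allVec-1 zero = refl
  ∑-allVec-1 (suc d) = begin
    ∑ (allVec (suc d)) (λ _ → 1) ≡⟨ ∑-allVec-suc _ ⟩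
    ∑ elems (λ a → ∑ (allVec d) (λ _ → 1)) ≡⟨ ∑-cong elems (λ a → ∑-allVec-1 d) ⟩
    ∑ elems (λ a → card ^ d) ≡⟨ ∑-const elems _ ⟩
    card ℕ.* card ^ d ∎
    where open ≡-Reasoning

  infixl 6 _⊖_
  _⊖_ : ∀ {d} → Vec Carrier d → Vec Carrier d → Vec Carrier d
  x ⊖ y = Vec.zipWith _-_ x y

  •-· : ∀ {d} u (x y : Vec Carrier d) → (u • x) · y ≡ u * (x · y)
  •-· u [] [] = sym (zeroʳ u)
  •-· u (a ∷ x) (b ∷ y) = trans (cong₂ _+_ (*-assoc u a b) (•-· u x y)) (sym (distribˡ u (a * b) (x · y)))

  ·-• : ∀ {d} c (x w : Vec Carrier d) → x · (c • w) ≡ c * (x · w)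
  ·-• c [] [] = sym (zeroʳ c)
  ·-• c (a ∷ x) (b ∷ w) = trans (cong₂ _+_ (x∙yz≈y∙xz a c b) (·-• c x w)) (sym (distribˡ c (a * b) (x · w)))

  ·-⊖ : ∀ {d} (x y y' : Vec Carrier d) → x · (y ⊖ y') ≡ x · y - x · y'
  ·-⊖ [] [] [] = sym (-‿inverseʳ 0#)
  ·-⊖ (a ∷ x) (b ∷ y) (b' ∷ y') = begin
    a * (b - b') + x · (y ⊖ y') ≡⟨ cong₂ _+_ *-distribˡ-- (·-⊖ x y y') ⟩
    (a * b - a * b') + (x · y - x · y') ≡⟨ +-interchange (a * b) (- (a * b')) (x · y) (- (x · y')) ⟩
    (a * b + x · y) + (- (a * b') + - (x · y')) ≡⟨ cong ((a * b + x · y) +_) (-‿+-comm (a * b') (x · y')) ⟩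
    (a * b + x · y) - (a * b' + x · y') ∎
    where
    open ≡-Reasoning
    *-distribˡ-- : a * (b - b') ≡ a * b - a * b'
    *-distribˡ-- = trans (distribˡ a b (- b')) (cong (a * b +_) (sym (-‿distribʳ-* a b')))

  ·≡·⇒·⊖≡0 : ∀ {d} (x y y' : Vec Carrier d) → x · y ≡ x · y' → x · (y ⊖ y') ≡ 0#
  ·≡·⇒·⊖≡0 x y y' e = trans (·-⊖ x y y') (x≡y⇒x-y≡0 e)

  ·⊖≡0⇒·≡· : ∀ {d} (x y y' : Vec Carrier d) → x · (y ⊖ y') ≡ 0# → x · y ≡ x · y'
  ·⊖≡0⇒·≡· x y y' e = x-y≡0⇒x≡y (trans (sym (·-⊖ x y y')) e)

  ⊖-involutive : ∀ {d} (y y' : Vec Carrier d) → y ⊖ (y ⊖ y') ≡ y'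
  ⊖-involutive [] [] = refl
  ⊖-involutive (a ∷ y) (b ∷ y') = cong₂ _∷_ a-[a-b]≡b (⊖-involutive y y')
    where
    a-[a-b]≡b : a - (a - b) ≡ b
    a-[a-b]≡b = begin
      a + - (a + - b) ≡⟨ cong (a +_) (sym (-‿+-comm a (- b))) ⟩
      a + (- a + - - b) ≡⟨ sym (+-assoc a (- a) (- - b)) ⟩
      (a - a) + - - b ≡⟨ cong (_+ - - b) (-‿inverseʳ a) ⟩
      0# + - - b ≡⟨ +-identityˡ _ ⟩
      - - b ≡⟨ -‿involutive b ⟩
      b ∎
      where open ≡-Reasoning

  Unimodular : ∀ {d} → Vec Carrier d → Set
  Unimodular x = ¬ AllNonUnit x

  unimodular? : ∀ {d} → Decidable (Unimodular {d})
  unimodular? x = ¬? (allNonUnit? x)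

  𝟙-unimodular+𝟙-allNonUnit≡1 : ∀ {d} (z : Vec Carrier d) → 𝟙 (unimodular? z) ℕ.+ 𝟙 (allNonUnit? z) ≡ 1
  𝟙-unimodular+𝟙-allNonUnit≡1 z with allNonUnit? z
  ... | yes _ = refl
  ... | no _ = refl

  unimodular⇒Any-unit : ∀ {d} {x : Vec Carrier d} → Unimodular x → VAny.Any IsUnit x
  unimodular⇒Any-unit {x = []} h = ⊥-elim (h [])
  unimodular⇒Any-unit {x = a ∷ x} h with isUnit? a
  ... | yes u = here u
  ... | no nu = there (unimodular⇒Any-unit (λ all → h (nu ∷ all)))

  Any-unit⇒unimodular : ∀ {d} {x : Vec Carrier d} → VAny.Any IsUnit x → Unimodular x
  Any-unit⇒unimodular (here u) (n ∷ _) = n u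
  Any-unit⇒unimodular (there a) (_ ∷ ns) = Any-unit⇒unimodular a ns

  •-unimodular : ∀ {d} {u} {x : Vec Carrier d} → IsUnit u → Unimodular x → Unimodular (u • x)
  •-unimodular {u = u} uu ux = Any-unit⇒unimodular (scale (unimodular⇒Any-unit ux))
    where
    scale : ∀ {d} {x : Vec Carrier d} → VAny.Any IsUnit x → VAny.Any IsUnit (u • x)
    scale (here h) = here (isUnit-* uu h)
    scale (there a) = there (scale a)

  •-cancelʳ : ∀ {d} {u u'} {x : Vec Carrier d} → Unimodular x → u • x ≡ u' • x → u ≡ u'
  •-cancelʳ {u = u} {u'} ux = go (unimodular⇒Any-unit ux)
    where
    go : ∀ {d} {x : Vec Carrier d} → VAny.Any IsUnit x → u • x ≡ u' • x → u ≡ u'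
    go {x = a ∷ x} (here (y , ay≡1)) e = begin
      u ≡⟨ sym (*-identityʳ u) ⟩
      u * 1# ≡⟨ cong (u *_) (sym ay≡1) ⟩
      u * (a * y) ≡⟨ sym (*-assoc u a y) ⟩
      u * a * y ≡⟨ cong (_* y) (VecP.∷-injectiveˡ e) ⟩
      u' * a * y ≡⟨ *-assoc u' a y ⟩
      u' * (a * y) ≡⟨ cong (u' *_) ay≡1 ⟩
      u' * 1# ≡⟨ *-identityʳ u' ⟩
      u' ∎
      where open ≡-Reasoning
    go {x = a ∷ x} (there h) e = go h (VecP.∷-injectiveʳ e)

  •-assoc : ∀ {d} u v (x : Vec Carrier d) → u • (v • x) ≡ (u * v) • x
  •-assoc u v [] = refl
  •-assoc u v (a ∷ x) = cong₂ _∷_ (sym (*-assoc u v a)) (•-assoc u v x)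

  •-identity : ∀ {d} (x : Vec Carrier d) → 1# • x ≡ x
  •-identity [] = refl
  •-identity (a ∷ x) = cong₂ _∷_ (*-identityˡ a) (•-identity x)

  ·-nonUnit : ∀ {d} (x w : Vec Carrier d) → AllNonUnit x → NonUnit (x · w)
  ·-nonUnit [] [] _ = nonUnit-0
  ·-nonUnit (a ∷ x) (b ∷ w) (na ∷ nx) = local (nonUnit-*ʳ b na) (·-nonUnit x w nx)

module LinearForms (R : FiniteChainRing) where

  open import Level using (0ℓ)
  open import Data.Nat as ℕ using (ℕ; suc; _^_)
  import Data.Nat.Properties as NP
  open import Data.Nat.Tactic.RingSolver using (solve-∀)
  open import Data.Product using (_,_)
  open import Data.Empty using (⊥-elim)
  open import Data.Vec using (Vec; []; _∷_)
  open import Data.Vec.Relation.Unary.All using ([]; _∷_)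
  open import Relation.Nullary using (yes; no)
  open import Relation.Unary using (Pred; Decidable)
  open import Relation.Binary.PropositionalEquality
  open FiniteSums
  open Vectors R public

  ∑-affine : ∀ b c → IsUnit b → (f : Carrier → ℕ) → ∑ elems (λ a → f (a * b + c)) ≡ ∑ elems f
  ∑-affine b c (b' , e) f = ∑-reindex elems elems-isEnum (λ a → a * b + c) (λ t → (t - c) * b') inv₁ inv₂ f
    where
    inv₁ : ∀ a → (a * b + c - c) * b' ≡ a
    inv₁ a = trans (cong (_* b') (x+y-y≡x (a * b) c)) (trans (*-assoc a b b') (trans (cong (a *_) e) (*-identityʳ a)))
    inv₂ : ∀ t → (t - c) * b' * b + c ≡ t
    inv₂ t = trans (cong (_+ c) (trans (*-assoc (t - c) b' b) (trans (cong ((t - c) *_) (trans (*-comm b' b) e)) (*-identityʳ (t - c)))))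
                   (x-y+y≡x t c)

  #_ : ∀ {S : Pred Carrier 0ℓ} → Decidable S → ℕ
  # S? = ∑ elems (λ t → 𝟙 (S? t))

  #-translate : ∀ {S : Pred Carrier 0ℓ} (S? : Decidable S) c → ∑ elems (λ t → 𝟙 (S? (c + t))) ≡ # S?
  #-translate S? c = trans (∑-cong elems (λ t → cong (λ z → 𝟙 (S? z)) (+-comm c t))) (∑-translate c (λ t → 𝟙 (S? t)))

  -- the counting identities below are multiplied through by |R| resp. |R⁰| to avoid division
  #preimage-· : ∀ {n} (w0 : Vec Carrier n) → Unimodular w0 → ∀ {S : Pred Carrier 0ℓ} (S? : Decidable S) →
    ∑ (allVec n) (λ x → 𝟙 (S? (x · w0))) ℕ.* card ≡ card ^ n ℕ.* # S?
  #preimage-· [] h S? = ⊥-elim (h [])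
  #preimage-· {suc n} (b ∷ w') h S? with isUnit? b
  ... | yes u = begin
    ∑ (allVec (suc n)) (λ x → 𝟙 (S? (x · (b ∷ w')))) ℕ.* card ≡⟨ cong (ℕ._* card) (∑-allVec-suc _) ⟩
    ∑ elems (λ a → ∑ (allVec n) (λ x → 𝟙 (S? (a * b + x · w')))) ℕ.* card ≡⟨ cong (ℕ._* card) (∑-swap elems (allVec n) _) ⟩
    ∑ (allVec n) (λ x → ∑ elems (λ a → 𝟙 (S? (a * b + x · w')))) ℕ.* card
      ≡⟨ cong (ℕ._* card) (∑-cong (allVec n) (λ x → ∑-affine b (x · w') u (λ t → 𝟙 (S? t)))) ⟩
    ∑ (allVec n) (λ x → # S?) ℕ.* card ≡⟨ cong (ℕ._* card) (trans (∑-cong (allVec n) (λ _ → sym (NP.*-identityˡ (# S?)))) (trans (∑-*ʳ (allVec n) (# S?) (λ _ → 1)) (cong (ℕ._* # S?) (∑-allVec-1 n)))) ⟩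
    card ^ n ℕ.* # S? ℕ.* card ≡⟨ rotate (card ^ n) (# S?) card ⟩
    card ℕ.* card ^ n ℕ.* # S? ∎
    where
    open ≡-Reasoning
    rotate : ∀ x y z → x ℕ.* y ℕ.* z ≡ z ℕ.* x ℕ.* y
    rotate = solve-∀
  ... | no nu = begin
    ∑ (allVec (suc n)) (λ x → 𝟙 (S? (x · (b ∷ w')))) ℕ.* card ≡⟨ cong (ℕ._* card) (∑-allVec-suc _) ⟩
    ∑ elems (λ a → ∑ (allVec n) (λ x → 𝟙 (S? (a * b + x · w')))) ℕ.* card ≡⟨ sym (∑-*ʳ elems card _) ⟩
    ∑ elems (λ a → ∑ (allVec n) (λ x → 𝟙 (S? (a * b + x · w'))) ℕ.* card)
      ≡⟨ ∑-cong elems (λ a → #preimage-· w' (λ all → h (nu ∷ all)) (λ t → S? (a * b + t))) ⟩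
    ∑ elems (λ a → card ^ n ℕ.* ∑ elems (λ t → 𝟙 (S? (a * b + t))))
      ≡⟨ ∑-cong elems (λ a → cong (card ^ n ℕ.*_) (#-translate S? (a * b))) ⟩
    ∑ elems (λ a → card ^ n ℕ.* # S?) ≡⟨ trans (∑-const elems _) (sym (NP.*-assoc card (card ^ n) (# S?))) ⟩
    card ℕ.* card ^ n ℕ.* # S? ∎
    where open ≡-Reasoning

  NU : ℕ
  NU = cardNonUnits

  -- for x ∈ (R⁰)^n, a ↦ a b + x·w' permutes R, and a b + x·w' ∈ S ⊆ R⁰ already forces a ∈ R⁰
  #nonUnitPreimage-·-unitHead : ∀ {n} b (w' : Vec Carrier n) → IsUnit b → ∀ {S : Pred Carrier 0ℓ} (S? : Decidable S) →
    (∀ t → S t → NonUnit t) →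
    ∑ (allVec (suc n)) (λ x → 𝟙 (allNonUnit? x) ℕ.* 𝟙 (S? (x · (b ∷ w')))) ℕ.* NU ≡ NU ℕ.* NU ^ n ℕ.* # S?
  #nonUnitPreimage-·-unitHead {n} b w' u S? hS = begin
    ∑ (allVec (suc n)) (λ x → 𝟙 (allNonUnit? x) ℕ.* 𝟙 (S? (x · (b ∷ w')))) ℕ.* NU ≡⟨ cong (ℕ._* NU) (∑-allVec-suc _) ⟩
    ∑ elems (λ a → ∑ (allVec n) (λ x → 𝟙 (allNonUnit? (a ∷ x)) ℕ.* 𝟙 (S? (a * b + x · w')))) ℕ.* NU
      ≡⟨ cong (ℕ._* NU) (∑-cong elems (λ a → ∑-cong (allVec n) (λ x →
           trans (cong (ℕ._* 𝟙 (S? (a * b + x · w'))) (𝟙-all?-∷ nonUnit? a x))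
                 (swap (𝟙 (nonUnit? a)) (𝟙 (allNonUnit? x)) (𝟙 (S? (a * b + x · w'))))))) ⟩
    ∑ elems (λ a → ∑ (allVec n) (λ x → 𝟙 (allNonUnit? x) ℕ.* (𝟙 (nonUnit? a) ℕ.* 𝟙 (S? (a * b + x · w'))))) ℕ.* NU
      ≡⟨ cong (ℕ._* NU) (∑-swap elems (allVec n) _) ⟩
    ∑ (allVec n) (λ x → ∑ elems (λ a → 𝟙 (allNonUnit? x) ℕ.* (𝟙 (nonUnit? a) ℕ.* 𝟙 (S? (a * b + x · w'))))) ℕ.* NU
      ≡⟨ cong (ℕ._* NU) (∑-cong (allVec n) (λ x → trans (∑-*ˡ elems (𝟙 (allNonUnit? x)) (λ a → 𝟙 (nonUnit? a) ℕ.* 𝟙 (S? (a * b + x · w')))) (∑nonUnit-affine x))) ⟩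
    ∑ (allVec n) (λ x → 𝟙 (allNonUnit? x) ℕ.* # S?) ℕ.* NU
      ≡⟨ cong (ℕ._* NU) (trans (∑-*ʳ (allVec n) (# S?) _) (cong (ℕ._* # S?) (trans (#All≡#^d nonUnit? n) (cong (_^ n) (sym cardNonUnits≡∑𝟙))))) ⟩
    NU ^ n ℕ.* # S? ℕ.* NU ≡⟨ rotate (NU ^ n) (# S?) NU ⟩
    NU ℕ.* NU ^ n ℕ.* # S? ∎
    where
    open ≡-Reasoning
    rotate : ∀ x y z → x ℕ.* y ℕ.* z ≡ z ℕ.* x ℕ.* y
    rotate = solve-∀
    swap : ∀ x y z → x ℕ.* y ℕ.* z ≡ y ℕ.* (x ℕ.* z)
    swap = solve-∀
    ∑nonUnit-affine : ∀ x → 𝟙 (allNonUnit? x) ℕ.* ∑ elems (λ a → 𝟙 (nonUnit? a) ℕ.* 𝟙 (S? (a * b + x · w')))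
                ≡ 𝟙 (allNonUnit? x) ℕ.* # S?
    ∑nonUnit-affine x with allNonUnit? x
    ... | no _ = refl
    ... | yes ax = cong (1 ℕ.*_) (trans (∑-cong elems S-forces-nonUnit) (∑-affine b (x · w') u (λ t → 𝟙 (S? t))))
      where
      S-forces-nonUnit : ∀ a → 𝟙 (nonUnit? a) ℕ.* 𝟙 (S? (a * b + x · w')) ≡ 𝟙 (S? (a * b + x · w'))
      S-forces-nonUnit a with S? (a * b + x · w')
      ... | no _ = NP.*-zeroʳ (𝟙 (nonUnit? a))
      ... | yes s rewrite 𝟙-yes (nonUnit? a) (λ ua → nonUnit-- (hS _ s) (·-nonUnit x w' ax)
                                (subst IsUnit (sym (x+y-y≡x (a * b) (x · w'))) (isUnit-* ua u))) = refl

  #nonUnitPreimage-· : ∀ {n} (w0 : Vec Carrier n) → Unimodular w0 → ∀ {S : Pred Carrier 0ℓ} (S? : Decidable S) →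
    (∀ t → S t → NonUnit t) →
    ∑ (allVec n) (λ x → 𝟙 (allNonUnit? x) ℕ.* 𝟙 (S? (x · w0))) ℕ.* NU ≡ NU ^ n ℕ.* # S?
  #nonUnitPreimage-· [] h S? hS = ⊥-elim (h [])
  #nonUnitPreimage-· {suc n} (b ∷ w') h S? hS with isUnit? b
  ... | yes u = #nonUnitPreimage-·-unitHead b w' u S? hS
  ... | no nu = begin
    ∑ (allVec (suc n)) (λ x → 𝟙 (allNonUnit? x) ℕ.* 𝟙 (S? (x · (b ∷ w')))) ℕ.* NU ≡⟨ cong (ℕ._* NU) (∑-allVec-suc _) ⟩
    ∑ elems (λ a → ∑ (allVec n) (λ x → 𝟙 (allNonUnit? (a ∷ x)) ℕ.* 𝟙 (S? (a * b + x · w')))) ℕ.* NU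
      ≡⟨ cong (ℕ._* NU) (∑-cong elems (λ a → trans (∑-cong (allVec n) (λ x →
           trans (cong (ℕ._* 𝟙 (S? (a * b + x · w'))) (𝟙-all?-∷ nonUnit? a x))
                 (NP.*-assoc (𝟙 (nonUnit? a)) (𝟙 (allNonUnit? x)) (𝟙 (S? (a * b + x · w'))))))
           (∑-*ˡ (allVec n) (𝟙 (nonUnit? a)) (λ x → 𝟙 (allNonUnit? x) ℕ.* 𝟙 (S? (a * b + x · w')))))) ⟩
    ∑ elems (λ a → 𝟙 (nonUnit? a) ℕ.* ∑ (allVec n) (λ x → 𝟙 (allNonUnit? x) ℕ.* 𝟙 (S? (a * b + x · w')))) ℕ.* NU
      ≡⟨ sym (∑-*ʳ elems NU _) ⟩
    ∑ elems (λ a → 𝟙 (nonUnit? a) ℕ.* ∑ (allVec n) (λ x → 𝟙 (allNonUnit? x) ℕ.* 𝟙 (S? (a * b + x · w'))) ℕ.* NU)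
      ≡⟨ ∑-cong elems recurse ⟩
    ∑ elems (λ a → 𝟙 (nonUnit? a) ℕ.* (NU ^ n ℕ.* # S?)) ≡⟨ ∑-*ʳ elems _ _ ⟩
    ∑ elems (λ a → 𝟙 (nonUnit? a)) ℕ.* (NU ^ n ℕ.* # S?) ≡⟨ cong (ℕ._* (NU ^ n ℕ.* # S?)) (sym cardNonUnits≡∑𝟙) ⟩
    NU ℕ.* (NU ^ n ℕ.* # S?) ≡⟨ sym (NP.*-assoc NU (NU ^ n) (# S?)) ⟩
    NU ℕ.* NU ^ n ℕ.* # S? ∎
    where
    open ≡-Reasoning
    recurse : ∀ a → 𝟙 (nonUnit? a) ℕ.* ∑ (allVec n) (λ x → 𝟙 (allNonUnit? x) ℕ.* 𝟙 (S? (a * b + x · w'))) ℕ.* NU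
                ≡ 𝟙 (nonUnit? a) ℕ.* (NU ^ n ℕ.* # S?)
    recurse a with nonUnit? a
    ... | no _ = refl
    ... | yes na = trans (NP.*-assoc 1 (∑ (allVec n) (λ x → 𝟙 (allNonUnit? x) ℕ.* 𝟙 (S? (a * b + x · w')))) NU) (cong (1 ℕ.*_) (trans
          (#nonUnitPreimage-· w' (λ all → h (nu ∷ all)) (λ t → S? (a * b + t))
            (λ t s → subst NonUnit (trans (cong (_- (a * b)) (+-comm (a * b) t)) (x+y-y≡x t (a * b)))
                       (nonUnit-- (hS _ s) (subst NonUnit (*-comm b a) (nonUnit-*ˡ b na)))))
          (cong (NU ^ n ℕ.*_) (#-translate S? (a * b)))))



module OrthogonalCount (R : FiniteChainRing) (q' r : Data.Nat.ℕ)
  (card≡q^r : FCR.card R PEq.≡ (2 Data.Nat.+ q') Data.Nat.^ r)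
  (card≡q*cardNonUnits : FCR.card R PEq.≡ (2 Data.Nat.+ q') Data.Nat.* FCR.cardNonUnits R) where

  open import Data.Nat as ℕ using (ℕ; zero; suc; _≤_; _<_; z≤n; s≤s; _^_)
  import Data.Nat.Properties as NP
  open import Data.Nat.Tactic.RingSolver using (solve-∀)
  open import Data.Product using (Σ; _×_; _,_)
  open import Data.Sum using (_⊎_; inj₁; inj₂)
  open import Data.Vec using (Vec; []; _∷_; replicate)
  open import Data.Vec.Relation.Unary.All as VAll using ([]; _∷_)
  open import Relation.Nullary using (¬_; yes; no)
  open import Relation.Unary using (Decidable)
  open import Relation.Binary.PropositionalEquality
  open FiniteSums
  open ChainRingSize R q' r card≡q^r card≡q*cardNonUnits public
    using (q; cardNonUnits≢0; #ann-π^j≡q^j; π^r≡0; #ideal-π^k*q^k≡q^r; π^j*b≡0⇒nonUnit)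
  open LinearForms R public

  infix 4 π^_∣ᵛ_
  π^_∣ᵛ_ : ∀ {d} → ℕ → Vec Carrier d → Set
  π^ k ∣ᵛ w = VAll.All (π^ k ∣_) w

  π^_∣ᵛ?_ : ∀ {d} k → Decidable (π^_∣ᵛ_ {d} k)
  π^ k ∣ᵛ? w = VAll.all? (π^ k ∣?_) w

  π^0∣ᵛ : ∀ {d} (w : Vec Carrier d) → π^ 0 ∣ᵛ w
  π^0∣ᵛ [] = []
  π^0∣ᵛ (b ∷ w) = (b , sym (*-identityˡ b)) ∷ π^0∣ᵛ w

  π^-split : ∀ k m → π^ (k ℕ.+ m) ≡ π^ k * π^ m
  π^-split zero m = sym (*-identityˡ (π^ m))
  π^-split (suc k) m = trans (cong (π *_) (π^-split k m)) (sym (*-assoc π (π^ k) (π^ m)))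

  π^∣ᵛ-weaken : ∀ {n} {k j} (w : Vec Carrier n) → k ≤ j → π^ j ∣ᵛ w → π^ k ∣ᵛ w
  π^∣ᵛ-weaken [] k≤j [] = []
  π^∣ᵛ-weaken {k = k} {j} (b ∷ w) k≤j ((c , b≡π^jc) ∷ hs) =
    (π^ (j ℕ.∸ k) * c , trans b≡π^jc (trans (cong (_* c) (trans (cong π^_ (sym (NP.m+[n∸m]≡n k≤j))) (π^-split k (j ℕ.∸ k))))
                           (*-assoc (π^ k) (π^ (j ℕ.∸ k)) c))) ∷ π^∣ᵛ-weaken w k≤j hs

  ExactPower : ∀ {d} → Vec Carrier d → Set
  ExactPower w = Σ ℕ λ j → j < r × π^ j ∣ᵛ w × ¬ π^ suc j ∣ᵛ w

  exactPower⊎π^r∣ᵛ : ∀ {d} (w : Vec Carrier d) → ExactPower w ⊎ π^ r ∣ᵛ w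
  exactPower⊎π^r∣ᵛ w = search r 0 refl (π^0∣ᵛ w)
    where
    search : ∀ m j → j ℕ.+ m ≡ r → π^ j ∣ᵛ w → ExactPower w ⊎ π^ r ∣ᵛ w
    search zero j j+0≡r h = inj₂ (subst (λ k → π^ k ∣ᵛ w) (trans (sym (NP.+-identityʳ j)) j+0≡r) h)
    search (suc m) j j+1+m≡r h with π^ suc j ∣ᵛ? w
    ... | yes h' = search m (suc j) (trans (sym (NP.+-suc j m)) j+1+m≡r) h'
    ... | no ¬h' = inj₁ (j , subst (j <_) j+1+m≡r (NP.m<m+n j (s≤s z≤n)) , h , ¬h')

  divideBy : ∀ {c d} {w : Vec Carrier d} → VAll.All (c ∣_) w → Vec Carrier d
  divideBy [] = []
  divideBy ((e , _) ∷ hs) = e ∷ divideBy hs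

  ≡•divideBy : ∀ {c d} {w : Vec Carrier d} (h : VAll.All (c ∣_) w) → w ≡ c • divideBy h
  ≡•divideBy [] = refl
  ≡•divideBy ((e , p) ∷ hs) = cong₂ _∷_ p (≡•divideBy hs)

  divideBy-unimodular : ∀ j {d} {w : Vec Carrier d} (h : π^ j ∣ᵛ w) → ¬ π^ suc j ∣ᵛ w → Unimodular (divideBy h)
  divideBy-unimodular j h ¬h' nonUnits = ¬h' (go h nonUnits)
    where
    go : ∀ {d} {w : Vec Carrier d} (h : π^ j ∣ᵛ w) → AllNonUnit (divideBy h) → π^ suc j ∣ᵛ w
    go [] [] = []
    go ((e , p) ∷ hs) (ne ∷ ns) with nonUnit⇒π∣ e ne
    ... | f , ef = (f , trans p (trans (cong (π^ j *_) ef)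
         (trans (sym (*-assoc (π^ j) π f)) (cong (_* f) (*-comm (π^ j) π))))) ∷ go hs ns

  π^r∣ᵛ⇒≡0 : ∀ {d} {w : Vec Carrier d} → π^ r ∣ᵛ w → w ≡ replicate _ 0#
  π^r∣ᵛ⇒≡0 [] = refl
  π^r∣ᵛ⇒≡0 ((c , e) ∷ hs) = cong₂ _∷_ (trans e (trans (cong (_* c) π^r≡0) (zeroˡ c))) (π^r∣ᵛ⇒≡0 hs)

  ·-zeroʳ : ∀ {d} (z : Vec Carrier d) → z · replicate _ 0# ≡ 0#
  ·-zeroʳ [] = refl
  ·-zeroʳ (a ∷ z) = trans (cong₂ _+_ (zeroʳ a) (·-zeroʳ z)) (+-identityʳ 0#)

  #π^∣ᵛ : ∀ d k → ∑ (allVec d) (λ w → 𝟙 (π^ k ∣ᵛ? w)) ≡ #ideal (π^ k) ^ d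
  #π^∣ᵛ d k = #All≡#^d (π^ k ∣?_) d

  #unimodular : ℕ → ℕ
  #unimodular d = ∑ (allVec d) (λ z → 𝟙 (unimodular? z))

  #unimodular+NU^d≡card^d : ∀ d → #unimodular d ℕ.+ NU ^ d ≡ card ^ d
  #unimodular+NU^d≡card^d d = begin
    #unimodular d ℕ.+ NU ^ d ≡⟨ cong (#unimodular d ℕ.+_) (trans (cong (_^ d) cardNonUnits≡∑𝟙) (sym (#All≡#^d nonUnit? d))) ⟩
    #unimodular d ℕ.+ ∑ (allVec d) (λ z → 𝟙 (allNonUnit? z)) ≡⟨ sym (∑-+ (allVec d) _ _) ⟩
    ∑ (allVec d) (λ z → 𝟙 (unimodular? z) ℕ.+ 𝟙 (allNonUnit? z)) ≡⟨ ∑-cong (allVec d) 𝟙-unimodular+𝟙-allNonUnit≡1 ⟩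
    ∑ (allVec d) (λ z → 1) ≡⟨ ∑-allVec-1 d ⟩
    card ^ d ∎
    where open ≡-Reasoning

  #orthogonal : ∀ {d} → Vec Carrier d → ℕ
  #orthogonal {d} w = ∑ (allVec d) (λ z → 𝟙 (unimodular? z) ℕ.* 𝟙 (z · w ≟' 0#))

  #orthogonal-π^r : ∀ {d} (w : Vec Carrier d) → π^ r ∣ᵛ w → #orthogonal w ≡ #unimodular d
  #orthogonal-π^r {d} w h = ∑-cong (allVec d) (λ z →
    trans (cong (λ v → 𝟙 (unimodular? z) ℕ.* 𝟙 (z · v ≟' 0#)) (π^r∣ᵛ⇒≡0 h))
    (trans (cong (𝟙 (unimodular? z) ℕ.*_) (𝟙-yes (z · replicate _ 0# ≟' 0#) (·-zeroʳ z))) (NP.*-identityʳ _)))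

  instance
    card≢0 : ℕ.NonZero card
    card≢0 = ℕ.≢-nonZero (λ e → NP.<⇒≢ (NP.m^n>0 q r) (sym (trans (sym card≡q^r) e)))

  -- For w = π^j w₀ with w₀ unimodular, z·w = 0 iff π^j kills z·w₀; count all z this way and
  -- subtract those in (R⁰)^d.
  #orthogonal-exact : ∀ {a} (w : Vec Carrier (suc a)) j → j < r → π^ j ∣ᵛ w → ¬ π^ suc j ∣ᵛ w →
    #orthogonal w ℕ.+ NU ^ a ℕ.* q ^ j ≡ card ^ a ℕ.* q ^ j
  #orthogonal-exact {a} w j j<r h ¬h' = begin
    #orthogonal w ℕ.+ NU ^ a ℕ.* q ^ j ≡⟨ cong₂ ℕ._+_ #orthogonal≡ (sym #nonUnit-killed) ⟩
    ∑ (allVec d) (λ z → 𝟙 (unimodular? z) ℕ.* killed z) ℕ.+ ∑ (allVec d) (λ z → 𝟙 (allNonUnit? z) ℕ.* killed z)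
      ≡⟨ sym (∑-+ (allVec d) _ _) ⟩
    ∑ (allVec d) (λ z → 𝟙 (unimodular? z) ℕ.* killed z ℕ.+ 𝟙 (allNonUnit? z) ℕ.* killed z)
      ≡⟨ ∑-cong (allVec d) (λ z → trans (sym (NP.*-distribʳ-+ (killed z) (𝟙 (unimodular? z)) (𝟙 (allNonUnit? z))))
            (trans (cong (ℕ._* killed z) (𝟙-unimodular+𝟙-allNonUnit≡1 z)) (NP.*-identityˡ _))) ⟩
    ∑ (allVec d) killed ≡⟨ #killed ⟩
    card ^ a ℕ.* q ^ j ∎
    where
    open ≡-Reasoning
    d = suc a
    w₀ = divideBy h
    w₀-unimodular = divideBy-unimodular j h ¬h'
    S? : Decidable (λ t → π^ j * t ≡ 0#)
    S? t = π^ j * t ≟' 0#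
    killed : Vec Carrier d → ℕ
    killed z = 𝟙 (S? (z · w₀))
    #S : # S? ≡ q ^ j
    #S = #ann-π^j≡q^j j (NP.<⇒≤ j<r)
    rotate : ∀ x y z → x ℕ.* y ℕ.* z ≡ y ℕ.* z ℕ.* x
    rotate = solve-∀
    #orthogonal≡ : #orthogonal w ≡ ∑ (allVec d) (λ z → 𝟙 (unimodular? z) ℕ.* killed z)
    #orthogonal≡ = ∑-cong (allVec d) (λ z → cong (λ v → 𝟙 (unimodular? z) ℕ.* 𝟙 (v ≟' 0#))
             (trans (cong (z ·_) (≡•divideBy h)) (·-• (π^ j) z w₀)))
    #killed : ∑ (allVec d) killed ≡ card ^ a ℕ.* q ^ j
    #killed = NP.*-cancelʳ-≡ _ (card ^ a ℕ.* q ^ j) card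
      (trans (#preimage-· w₀ w₀-unimodular S?) (trans (cong (card ^ d ℕ.*_) #S) (rotate card (card ^ a) (q ^ j))))
    #nonUnit-killed : ∑ (allVec d) (λ z → 𝟙 (allNonUnit? z) ℕ.* killed z) ≡ NU ^ a ℕ.* q ^ j
    #nonUnit-killed = NP.*-cancelʳ-≡ _ (NU ^ a ℕ.* q ^ j) NU
      (trans (#nonUnitPreimage-· w₀ w₀-unimodular S? (π^j*b≡0⇒nonUnit j j<r))
        (trans (cong (NU ^ d ℕ.*_) #S) (rotate NU (NU ^ a) (q ^ j))))

module Energy (R : FiniteChainRing) (d : Data.Nat.ℕ)
  {F G : Relation.Unary.Pred (Data.Vec.Vec (FiniteChainRing.Carrier R) d) Level.0ℓ}
  (F? : Relation.Unary.Decidable F) (G? : Relation.Unary.Decidable G) where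

  open import Data.Nat as ℕ using (ℕ; _≤_)
  import Data.Nat.Properties as NP
  open import Data.Nat.Tactic.RingSolver using (solve-∀)
  open import Data.List using (List; length; filter; cartesianProduct)
  open import Data.Vec using (Vec)
  open import Relation.Nullary.Decidable using (_×-dec_)
  open import Relation.Binary.PropositionalEquality
  open FiniteSums
  open Dispersion using (cauchy-schwarzℕ; dispersion-∑≤ℕ)
  open Vectors R

  #F #G : ℕ
  #F = ∑ (allVec d) (λ x → 𝟙 (F? x))
  #G = ∑ (allVec d) (λ y → 𝟙 (G? y))

  count-F≡#F : count F? ≡ #F
  count-F≡#F = length-filter≡∑𝟙 F? (allVec d)

  count-G≡#G : count G? ≡ #G
  count-G≡#G = length-filter≡∑𝟙 G? (allVec d)

  Fs : List (Vec Carrier d)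
  Fs = filter F? (allVec d)

  length-Fs : length Fs ≡ #F
  length-Fs = length-filter≡∑𝟙 F? (allVec d)

  νₓ : Vec Carrier d → Carrier → ℕ
  νₓ x t = ∑ (allVec d) (λ y → 𝟙 (G? y) ℕ.* 𝟙 (x · y ≟' t))

  ν≡∑νₓ : ∀ t → ν F? G? t ≡ ∑ Fs (λ x → νₓ x t)
  ν≡∑νₓ t = begin
    ν F? G? t ≡⟨ length-filter≡∑𝟙 _ (cartesianProduct (allVec d) (allVec d)) ⟩
    ∑ (cartesianProduct (allVec d) (allVec d)) _ ≡⟨ ∑-cartesianProduct (allVec d) (allVec d) _ ⟩
    ∑ (allVec d) (λ x → ∑ (allVec d) (λ y → 𝟙 (((F? x) ×-dec (G? y)) ×-dec ((x · y) ≟ t))))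
      ≡⟨ ∑-cong (allVec d) (λ x → ∑-cong (allVec d) (λ y → trans (𝟙-× ((F? x) ×-dec (G? y)) ((x · y) ≟ t))
            (trans (cong (ℕ._* 𝟙 ((x · y) ≟ t)) (𝟙-× (F? x) (G? y))) (NP.*-assoc (𝟙 (F? x)) (𝟙 (G? y)) _)))) ⟩
    ∑ (allVec d) (λ x → ∑ (allVec d) (λ y → 𝟙 (F? x) ℕ.* (𝟙 (G? y) ℕ.* 𝟙 (x · y ≟' t))))
      ≡⟨ ∑-cong (allVec d) (λ x → ∑-*ˡ (allVec d) (𝟙 (F? x)) _) ⟩
    ∑ (allVec d) (λ x → 𝟙 (F? x) ℕ.* νₓ x t) ≡⟨ sym (∑-filter F? (allVec d) (λ x → νₓ x t)) ⟩
    ∑ Fs (λ x → νₓ x t) ∎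
    where open ≡-Reasoning

  ∑νₓ≡#G : ∀ x → ∑ elems (νₓ x) ≡ #G
  ∑νₓ≡#G x = begin
    ∑ elems (νₓ x) ≡⟨ ∑-swap elems (allVec d) _ ⟩
    ∑ (allVec d) (λ y → ∑ elems (λ t → 𝟙 (G? y) ℕ.* 𝟙 (x · y ≟' t))) ≡⟨ ∑-cong (allVec d) (λ y → ∑-*ˡ elems (𝟙 (G? y)) _) ⟩
    ∑ (allVec d) (λ y → 𝟙 (G? y) ℕ.* ∑ elems (λ t → 𝟙 (x · y ≟' t)))
      ≡⟨ ∑-cong (allVec d) (λ y → cong (𝟙 (G? y) ℕ.*_)
           (trans (∑-cong elems (λ t → 𝟙-cong (x · y ≟' t) (t ≟' x · y) sym sym)) (elems-isEnum (x · y)))) ⟩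
    ∑ (allVec d) (λ y → 𝟙 (G? y) ℕ.* 1) ≡⟨ ∑-cong (allVec d) (λ y → NP.*-identityʳ _) ⟩
    #G ∎
    where open ≡-Reasoning

  ∑ν≡#F*#G : ∑ elems (ν F? G?) ≡ #F ℕ.* #G
  ∑ν≡#F*#G = begin
    ∑ elems (ν F? G?) ≡⟨ ∑-cong elems ν≡∑νₓ ⟩
    ∑ elems (λ t → ∑ Fs (λ x → νₓ x t)) ≡⟨ ∑-swap elems Fs _ ⟩
    ∑ Fs (λ x → ∑ elems (νₓ x)) ≡⟨ ∑-cong Fs ∑νₓ≡#G ⟩
    ∑ Fs (λ x → #G) ≡⟨ ∑-const Fs #G ⟩
    length Fs ℕ.* #G ≡⟨ cong (ℕ._* #G) length-Fs ⟩
    #F ℕ.* #G ∎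
    where open ≡-Reasoning

  collisions : Vec Carrier d → ℕ
  collisions x = ∑ elems (λ t → νₓ x t ℕ.* νₓ x t)

  #G²≤card*collisions : ∀ x → #G ℕ.* #G ≤ card ℕ.* collisions x
  #G²≤card*collisions x = subst₂ _≤_ (cong₂ ℕ._*_ (∑νₓ≡#G x) (∑νₓ≡#G x)) refl (cauchy-schwarzℕ elems (νₓ x))

  -- the truncated subtraction is exact by #G²≤card*collisions
  excess : Vec Carrier d → ℕ
  excess x = card ℕ.* collisions x ℕ.∸ #G ℕ.* #G

  excess+#G²≡card*collisions : ∀ x → excess x ℕ.+ #G ℕ.* #G ≡ card ℕ.* collisions x
  excess+#G²≡card*collisions x = NP.m∸n+n≡m (#G²≤card*collisions x)

  card*sumν²≤ : card ℕ.* sumν² F? G? ≤ (#F ℕ.* #G) ℕ.* (#F ℕ.* #G) ℕ.+ #F ℕ.* ∑ Fs excess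
  card*sumν²≤ = NP.+-cancelʳ-≤ (#F ℕ.* (#F ℕ.* (#G ℕ.* #G))) _ _ (subst₂ _≤_ lhs≡ rhs≡ (dispersion-∑≤ℕ elems Fs νₓ))
    where
    ∑ν≡ : ∑ elems (λ t → ∑ Fs (λ x → νₓ x t)) ≡ #F ℕ.* #G
    ∑ν≡ = trans (∑-cong elems (λ t → sym (ν≡∑νₓ t))) ∑ν≡#F*#G
    distrib : ∀ a b c e → a ℕ.+ b ℕ.* (c ℕ.+ e) ≡ a ℕ.+ b ℕ.* c ℕ.+ b ℕ.* e
    distrib = solve-∀
    lhs≡ : length elems ℕ.* ∑ elems (λ t → ∑ Fs (λ x → νₓ x t) ℕ.* ∑ Fs (λ x → νₓ x t))
           ℕ.+ length Fs ℕ.* ∑ Fs (λ x → ∑ elems (νₓ x) ℕ.* ∑ elems (νₓ x))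
         ≡ card ℕ.* sumν² F? G? ℕ.+ #F ℕ.* (#F ℕ.* (#G ℕ.* #G))
    lhs≡ = cong₂ ℕ._+_
           (cong (card ℕ.*_) (trans (∑-cong elems (λ t → sym (cong₂ ℕ._*_ (ν≡∑νₓ t) (ν≡∑νₓ t))))
                                    (sym (sum-map≡∑ elems (λ t → ν F? G? t ℕ.* ν F? G? t)))))
           (trans (cong₂ ℕ._*_ length-Fs (trans (∑-cong Fs (λ x → cong₂ ℕ._*_ (∑νₓ≡#G x) (∑νₓ≡#G x))) (∑-const Fs _)))
                  (cong (λ z → #F ℕ.* (z ℕ.* (#G ℕ.* #G))) length-Fs))
    rhs≡ : ∑ elems (λ t → ∑ Fs (λ x → νₓ x t)) ℕ.* ∑ elems (λ t → ∑ Fs (λ x → νₓ x t))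
           ℕ.+ length Fs ℕ.* ∑ Fs (λ x → length elems ℕ.* ∑ elems (λ t → νₓ x t ℕ.* νₓ x t))
         ≡ (#F ℕ.* #G) ℕ.* (#F ℕ.* #G) ℕ.+ #F ℕ.* ∑ Fs excess ℕ.+ #F ℕ.* (#F ℕ.* (#G ℕ.* #G))
    rhs≡ = begin
      _ ≡⟨ cong₂ ℕ._+_ (cong₂ ℕ._*_ ∑ν≡ ∑ν≡) (cong₂ ℕ._*_ length-Fs (∑-cong Fs (λ x → sym (excess+#G²≡card*collisions x)))) ⟩
      (#F ℕ.* #G) ℕ.* (#F ℕ.* #G) ℕ.+ #F ℕ.* ∑ Fs (λ x → excess x ℕ.+ #G ℕ.* #G)
        ≡⟨ cong (λ z → (#F ℕ.* #G) ℕ.* (#F ℕ.* #G) ℕ.+ #F ℕ.* z)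
             (trans (∑-+ Fs excess _) (cong (∑ Fs excess ℕ.+_) (trans (∑-const Fs _) (cong (ℕ._* (#G ℕ.* #G)) length-Fs)))) ⟩
      (#F ℕ.* #G) ℕ.* (#F ℕ.* #G) ℕ.+ #F ℕ.* (∑ Fs excess ℕ.+ #F ℕ.* (#G ℕ.* #G)) ≡⟨ distrib _ #F (∑ Fs excess) _ ⟩
      (#F ℕ.* #G) ℕ.* (#F ℕ.* #G) ℕ.+ #F ℕ.* ∑ Fs excess ℕ.+ #F ℕ.* (#F ℕ.* (#G ℕ.* #G)) ∎
      where open ≡-Reasoning

  coincidence : Vec Carrier d → Vec Carrier d → Vec Carrier d → ℕ
  coincidence x y y' = 𝟙 (G? y) ℕ.* 𝟙 (G? y') ℕ.* 𝟙 (x · (y ⊖ y') ≟' 0#)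

  collisions≡∑coincidence : ∀ x → collisions x ≡ ∑ (allVec d) (λ y → ∑ (allVec d) (coincidence x y))
  collisions≡∑coincidence x = begin
    collisions x ≡⟨ ∑-cong elems (λ t → ∑*∑ (allVec d) (allVec d) _ _) ⟩
    ∑ elems (λ t → ∑ (allVec d) (λ y → ∑ (allVec d) (λ y' → (𝟙 (G? y) ℕ.* 𝟙 (x · y ≟' t)) ℕ.* (𝟙 (G? y') ℕ.* 𝟙 (x · y' ≟' t)))))
      ≡⟨ trans (∑-swap elems (allVec d) _) (∑-cong (allVec d) (λ y → ∑-swap elems (allVec d) _)) ⟩
    ∑ (allVec d) (λ y → ∑ (allVec d) (λ y' → ∑ elems (λ t → (𝟙 (G? y) ℕ.* 𝟙 (x · y ≟' t)) ℕ.* (𝟙 (G? y') ℕ.* 𝟙 (x · y' ≟' t)))))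
      ≡⟨ ∑-cong (allVec d) (λ y → ∑-cong (allVec d) (pair y)) ⟩
    ∑ (allVec d) (λ y → ∑ (allVec d) (coincidence x y)) ∎
    where
    open ≡-Reasoning
    interchange : ∀ a b c e → (a ℕ.* b) ℕ.* (c ℕ.* e) ≡ (a ℕ.* c) ℕ.* (b ℕ.* e)
    interchange = solve-∀
    same-value : ∀ y y' → ∑ elems (λ t → 𝟙 (x · y ≟' t) ℕ.* 𝟙 (x · y' ≟' t)) ≡ 𝟙 (x · (y ⊖ y') ≟' 0#)
    same-value y y' = trans (∑-cong elems (λ t → cong (ℕ._* 𝟙 (x · y' ≟' t)) (𝟙-cong (x · y ≟' t) (t ≟' x · y) sym sym)))
      (trans (∑-δ elems elems-isEnum (λ t → 𝟙 (x · y' ≟' t)) (x · y))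
        (𝟙-cong (x · y' ≟' x · y) (x · (y ⊖ y') ≟' 0#) (λ e → ·≡·⇒·⊖≡0 x y y' (sym e)) (λ e → sym (·⊖≡0⇒·≡· x y y' e))))
    pair : ∀ y y' → ∑ elems (λ t → (𝟙 (G? y) ℕ.* 𝟙 (x · y ≟' t)) ℕ.* (𝟙 (G? y') ℕ.* 𝟙 (x · y' ≟' t))) ≡ coincidence x y y'
    pair y y' = begin
      _ ≡⟨ ∑-cong elems (λ t → interchange (𝟙 (G? y)) _ (𝟙 (G? y')) _) ⟩
      ∑ elems (λ t → (𝟙 (G? y) ℕ.* 𝟙 (G? y')) ℕ.* (𝟙 (x · y ≟' t) ℕ.* 𝟙 (x · y' ≟' t))) ≡⟨ ∑-*ˡ elems (𝟙 (G? y) ℕ.* 𝟙 (G? y')) (λ t → 𝟙 (x · y ≟' t) ℕ.* 𝟙 (x · y' ≟' t)) ⟩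
      (𝟙 (G? y) ℕ.* 𝟙 (G? y')) ℕ.* ∑ elems (λ t → 𝟙 (x · y ≟' t) ℕ.* 𝟙 (x · y' ≟' t))
        ≡⟨ cong ((𝟙 (G? y) ℕ.* 𝟙 (G? y')) ℕ.*_) (same-value y y') ⟩
      coincidence x y y' ∎

  collisions-• : ∀ {u} x → IsUnit u → collisions (u • x) ≡ collisions x
  collisions-• {u} x uu = trans (collisions≡∑coincidence (u • x)) (trans (∑-cong (allVec d) (λ y → ∑-cong (allVec d) (λ y' →
    cong (𝟙 (G? y) ℕ.* 𝟙 (G? y') ℕ.*_) (𝟙-cong ((u • x) · (y ⊖ y') ≟' 0#) (x · (y ⊖ y') ≟' 0#)
      (λ e → unit*x≡0⇒x≡0 uu (trans (sym (•-· u x (y ⊖ y'))) e))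
      (λ e → trans (•-· u x (y ⊖ y')) (trans (cong (u *_) e) (zeroʳ u))))))) (sym (collisions≡∑coincidence x)))

  excess-• : ∀ {u} x → IsUnit u → excess (u • x) ≡ excess x
  excess-• x uu = cong (λ z → card ℕ.* z ℕ.∸ #G ℕ.* #G) (collisions-• x uu)

module LineAveraging (R : FiniteChainRing) (d : Data.Nat.ℕ)
  {F G : Relation.Unary.Pred (Data.Vec.Vec (FiniteChainRing.Carrier R) d) Level.0ℓ}
  (F? : Relation.Unary.Decidable F) (G? : Relation.Unary.Decidable G)
  (F-unimodular : ∀ x → F x → Relation.Nullary.¬ FCR.AllNonUnit R x) where

  open import Data.Nat as ℕ using (ℕ; _≤_; z≤n; s≤s)
  import Data.Nat.Properties as NP
  open import Data.Nat.Tactic.RingSolver using (solve-∀)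
  open import Data.Product using (_,_)
  open import Data.Empty using (⊥-elim)
  open import Data.List using (List; _∷_; map; foldr)
  open import Data.List.Membership.Propositional using (_∈_)
  open import Data.List.Membership.Propositional.Properties using (∈-filter⁺)
  open import Data.List.Relation.Unary.Any using (here; there)
  open import Data.Vec using (Vec)
  open import Relation.Nullary using (yes; no)
  open import Relation.Nullary.Decidable using (_×-dec_; ¬?)
  open import Relation.Binary.PropositionalEquality
  open FiniteSums
  open Vectors R
  open Energy R d F? G?

  ≤-foldr-⊔ : ∀ {A : Set} (f : A → ℕ) (l : List A) a → a ∈ l → f a ≤ foldr ℕ._⊔_ 0 (map f l)
  ≤-foldr-⊔ f (b ∷ l) a (here refl) = NP.m≤m⊔n (f a) _
  ≤-foldr-⊔ f (b ∷ l) a (there a∈l) = NP.≤-trans (≤-foldr-⊔ f l a a∈l) (NP.m≤n⊔m (f b) _)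

  #F∩line≤maxLine : ∀ z → Unimodular z → ∑ (allVec d) (λ x → 𝟙 (F? x) ℕ.* 𝟙 (inLine? z x)) ≤ maxLine F?
  #F∩line≤maxLine z uz = subst (_≤ maxLine F?) #F∩line
    (≤-foldr-⊔ F∩line _ z (∈-filter⁺ (λ x → ¬? (allNonUnit? x)) (∈-allVec z) uz))
    where
    F∩line = λ x → count (λ y → F? y ×-dec inLine? x y)
    #F∩line : F∩line z ≡ ∑ (allVec d) (λ x → 𝟙 (F? x) ℕ.* 𝟙 (inLine? z x))
    #F∩line = trans (length-filter≡∑𝟙 _ (allVec d)) (∑-cong (allVec d) (λ x → 𝟙-× (F? x) (inLine? z x)))

  scalings : Vec Carrier d → Vec Carrier d → ℕ
  scalings z x = ∑ elems (λ u → 𝟙 (isUnit? u) ℕ.* 𝟙 (z ≟ᵛ (u • x)))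

  scalings≤1 : ∀ {z x v} → Unimodular x → z ≡ v • x → scalings z x ≤ 1
  scalings≤1 {z} {x} {v} ux z≡vx = subst (scalings z x ≤_) (elems-isEnum v) (∑-mono elems term≤)
    where
    term≤ : ∀ u → 𝟙 (isUnit? u) ℕ.* 𝟙 (z ≟ᵛ (u • x)) ≤ 𝟙 (u ≟ v)
    term≤ u with isUnit? u | z ≟ᵛ (u • x)
    ... | no _ | _ = z≤n
    ... | yes _ | no _ = z≤n
    ... | yes _ | yes z≡ux rewrite 𝟙-yes (u ≟ v) (•-cancelʳ ux (trans (sym z≡ux) z≡vx)) = s≤s z≤n

  scalings-0 : ∀ {z x} → (∀ {u} → IsUnit u → z ≢ u • x) → scalings z x ≡ 0
  scalings-0 {z} {x} never = trans (∑-cong elems term≡0) (∑-zero elems)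
    where
    term≡0 : ∀ u → 𝟙 (isUnit? u) ℕ.* 𝟙 (z ≟ᵛ (u • x)) ≡ 0
    term≡0 u with isUnit? u | z ≟ᵛ (u • x)
    ... | no _ | _ = refl
    ... | yes _ | no _ = refl
    ... | yes uu | yes z≡ux = ⊥-elim (never uu z≡ux)

  scalings≤𝟙-inLine : ∀ z x → Unimodular x → scalings z x ≤ 𝟙 (inLine? z x)
  scalings≤𝟙-inLine z x ux with inLine? z x
  ... | yes (s , (v , sv≡1) , x≡sz) = scalings≤1 ux (sym (begin
    v • x ≡⟨ cong (v •_) x≡sz ⟩
    v • (s • z) ≡⟨ •-assoc v s z ⟩
    (v * s) • z ≡⟨ cong (_• z) (trans (*-comm v s) sv≡1) ⟩
    1# • z ≡⟨ •-identity z ⟩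
    z ∎))
    where open ≡-Reasoning
  ... | no ∉line = NP.≤-reflexive (scalings-0 (λ { {u} (v , uv≡1) z≡ux →
    ∉line (v , isUnit-inverse (v , uv≡1) , (begin
      x ≡⟨ sym (•-identity x) ⟩
      1# • x ≡⟨ cong (_• x) (sym (trans (*-comm v u) uv≡1)) ⟩
      (v * u) • x ≡⟨ sym (•-assoc v u x) ⟩
      v • (u • x) ≡⟨ cong (v •_) (sym z≡ux) ⟩
      v • z ∎)) }))
    where open ≡-Reasoning

  preimages : Vec Carrier d → ℕ
  preimages z = ∑ (allVec d) (λ x → 𝟙 (F? x) ℕ.* scalings z x)

  preimages≤maxLine : ∀ z → preimages z ≤ 𝟙 (unimodular? z) ℕ.* maxLine F?
  preimages≤maxLine z with unimodular? z
  ... | yes uz = subst (preimages z ≤_) (sym (NP.*-identityˡ (maxLine F?)))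
                   (NP.≤-trans (∑-mono (allVec d) term≤) (#F∩line≤maxLine z uz))
    where
    term≤ : ∀ x → 𝟙 (F? x) ℕ.* scalings z x ≤ 𝟙 (F? x) ℕ.* 𝟙 (inLine? z x)
    term≤ x with F? x
    ... | no _ = z≤n
    ... | yes Fx = NP.*-monoʳ-≤ 1 (scalings≤𝟙-inLine z x (F-unimodular x Fx))
  ... | no ¬uz = NP.≤-reflexive (trans (∑-cong (allVec d) term≡0) (∑-zero (allVec d)))
    where
    term≡0 : ∀ x → 𝟙 (F? x) ℕ.* scalings z x ≡ 0
    term≡0 x with F? x
    ... | no _ = refl
    ... | yes Fx = trans (NP.*-identityˡ _) (scalings-0 (λ uu z≡ux →
                     ¬uz (subst Unimodular (sym z≡ux) (•-unimodular uu (F-unimodular x Fx)))))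

  -- Each x ∈ F contributes excess x = excess (u x) for all |R^*| units u, and the points u x
  -- hit by x ∈ F are unimodular, each at most maxLine F? times.
  #units*∑excess≤ : #units ℕ.* ∑ Fs excess ≤ maxLine F? ℕ.* ∑ (allVec d) (λ z → 𝟙 (unimodular? z) ℕ.* excess z)
  #units*∑excess≤ = begin
    #units ℕ.* ∑ Fs excess ≡⟨ sym (∑-*ˡ Fs #units excess) ⟩
    ∑ Fs (λ x → #units ℕ.* excess x) ≡⟨ ∑-filter F? (allVec d) _ ⟩
    ∑ (allVec d) (λ x → 𝟙 (F? x) ℕ.* (#units ℕ.* excess x))
      ≡⟨ ∑-cong (allVec d) (λ x → cong (𝟙 (F? x) ℕ.*_) (spread x)) ⟩
    ∑ (allVec d) (λ x → 𝟙 (F? x) ℕ.* ∑ elems (λ u → 𝟙 (isUnit? u) ℕ.* ∑ (allVec d) (λ z → 𝟙 (z ≟ᵛ (u • x)) ℕ.* excess z)))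
      ≡⟨ ∑-cong (allVec d) expand ⟩
    ∑ (allVec d) (λ x → ∑ elems (λ u → ∑ (allVec d) (λ z → excess z ℕ.* term x u z)))
      ≡⟨ trans (∑-cong (allVec d) (λ x → ∑-swap elems (allVec d) _)) (∑-swap (allVec d) (allVec d) _) ⟩
    ∑ (allVec d) (λ z → ∑ (allVec d) (λ x → ∑ elems (λ u → excess z ℕ.* term x u z)))
      ≡⟨ ∑-cong (allVec d) (λ z → trans (∑-cong (allVec d) (λ x → trans (∑-*ˡ elems (excess z) _)
            (cong (excess z ℕ.*_) (∑-*ˡ elems (𝟙 (F? x)) _)))) (∑-*ˡ (allVec d) (excess z) _)) ⟩
    ∑ (allVec d) (λ z → excess z ℕ.* preimages z) ≤⟨ ∑-mono (allVec d) (λ z → NP.*-monoʳ-≤ (excess z) (preimages≤maxLine z)) ⟩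
    ∑ (allVec d) (λ z → excess z ℕ.* (𝟙 (unimodular? z) ℕ.* maxLine F?))
      ≡⟨ ∑-cong (allVec d) (λ z → reorder (excess z) (𝟙 (unimodular? z)) (maxLine F?)) ⟩
    ∑ (allVec d) (λ z → maxLine F? ℕ.* (𝟙 (unimodular? z) ℕ.* excess z)) ≡⟨ ∑-*ˡ (allVec d) (maxLine F?) _ ⟩
    maxLine F? ℕ.* ∑ (allVec d) (λ z → 𝟙 (unimodular? z) ℕ.* excess z) ∎
    where
    open NP.≤-Reasoning
    term : Vec Carrier d → Carrier → Vec Carrier d → ℕ
    term x u z = 𝟙 (F? x) ℕ.* (𝟙 (isUnit? u) ℕ.* 𝟙 (z ≟ᵛ (u • x)))
    reorder : ∀ a b c → a ℕ.* (b ℕ.* c) ≡ c ℕ.* (b ℕ.* a)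
    reorder = solve-∀
    spread : ∀ x → #units ℕ.* excess x ≡ ∑ elems (λ u → 𝟙 (isUnit? u) ℕ.* ∑ (allVec d) (λ z → 𝟙 (z ≟ᵛ (u • x)) ℕ.* excess z))
    spread x = trans (sym (∑-*ʳ elems (excess x) _)) (∑-cong elems per-unit)
      where
      per-unit : ∀ u → 𝟙 (isUnit? u) ℕ.* excess x ≡ 𝟙 (isUnit? u) ℕ.* ∑ (allVec d) (λ z → 𝟙 (z ≟ᵛ (u • x)) ℕ.* excess z)
      per-unit u with isUnit? u
      ... | no _ = refl
      ... | yes uu = cong (1 ℕ.*_) (trans (sym (excess-• x uu)) (sym (VecEnumeration.∑-δ {d} (allVec d) (allVec-isEnum d) excess (u • x))))
    expand : ∀ x → 𝟙 (F? x) ℕ.* ∑ elems (λ u → 𝟙 (isUnit? u) ℕ.* ∑ (allVec d) (λ z → 𝟙 (z ≟ᵛ (u • x)) ℕ.* excess z))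
             ≡ ∑ elems (λ u → ∑ (allVec d) (λ z → excess z ℕ.* term x u z))
    expand x = trans (sym (∑-*ˡ elems (𝟙 (F? x)) _)) (∑-cong elems (λ u →
             trans (cong (𝟙 (F? x) ℕ.*_) (sym (∑-*ˡ (allVec d) (𝟙 (isUnit? u)) _)))
             (trans (sym (∑-*ˡ (allVec d) (𝟙 (F? x)) _))
               (∑-cong (allVec d) (λ z → rotate (𝟙 (F? x)) (𝟙 (isUnit? u)) (𝟙 (z ≟ᵛ (u • x))) (excess z))))))
      where
      rotate : ∀ a b c e → a ℕ.* (b ℕ.* (c ℕ.* e)) ≡ e ℕ.* (a ℕ.* (b ℕ.* c))
      rotate = solve-∀

module UnimodularExcess (R : FiniteChainRing) (q' s : Data.Nat.ℕ)
  (card≡q^r : FCR.card R PEq.≡ (2 Data.Nat.+ q') Data.Nat.^ Data.Nat.suc s)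
  (card≡q*cardNonUnits : FCR.card R PEq.≡ (2 Data.Nat.+ q') Data.Nat.* FCR.cardNonUnits R)
  (a : Data.Nat.ℕ) {F G : Relation.Unary.Pred (Data.Vec.Vec (FiniteChainRing.Carrier R) (Data.Nat.suc a)) Level.0ℓ}
  (F? : Relation.Unary.Decidable F) (G? : Relation.Unary.Decidable G) where

  open import Data.Nat as ℕ using (ℕ; zero; suc; _≤_; _<_; _^_)
  import Data.Nat.Properties as NP
  open import Data.Nat.Tactic.RingSolver using (solve-∀)
  open import Data.List using (List)
  open import Data.Product using (_,_)
  open import Data.Sum using (inj₁; inj₂)
  open import Data.Vec using (Vec)
  open import Relation.Nullary using (¬_)
  open import Relation.Binary.PropositionalEquality
  open FiniteSums
  open PowerSums
  open OrthogonalCount R q' (suc s) card≡q^r card≡q*cardNonUnits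
  open Energy R (suc a) F? G?

  d r : ℕ
  d = suc a
  r = suc s

  q-1 : ℕ
  q-1 = suc q'

  NU≡q^s : NU ≡ q ^ s
  NU≡q^s = NP.*-cancelˡ-≡ NU (q ^ s) q (trans (sym card≡q*cardNonUnits) card≡q^r)

  card^a≡q^a*NU^a : card ^ a ≡ q ^ a ℕ.* NU ^ a
  card^a≡q^a*NU^a = trans (cong (_^ a) (trans card≡q^r (cong (q ℕ.*_) (sym NU≡q^s)))) (^-distribʳ-* q NU a)

  t : ℕ
  t = q ^ a ℕ.∸ 1

  q^a≡1+t : q ^ a ≡ suc t
  q^a≡1+t = sym (NP.suc-pred (q ^ a) {{NP.m^n≢0 q a}})

  #units≡q-1*q^s : #units ≡ q-1 ℕ.* q ^ s
  #units≡q-1*q^s = NP.+-cancelʳ-≡ (q ^ s) #units (q-1 ℕ.* q ^ s)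
    (trans (cong (#units ℕ.+_) (sym NU≡q^s)) (trans #units+cardNonUnits≡card (trans card≡q^r (NP.+-comm (q ^ s) _))))

  -- the number of unimodular z orthogonal to a unimodular w
  #orth₀ : ℕ
  #orth₀ = card ^ a ℕ.∸ NU ^ a

  #orth₀≡t*NU^a : #orth₀ ≡ t ℕ.* NU ^ a
  #orth₀≡t*NU^a = trans (cong (ℕ._∸ NU ^ a) (trans card^a≡q^a*NU^a (cong (ℕ._* NU ^ a) q^a≡1+t))) (NP.m+n∸m≡n (NU ^ a) (t ℕ.* NU ^ a))

  #orthogonal-exact≡ : ∀ w j → j < r → π^ j ∣ᵛ w → ¬ π^ suc j ∣ᵛ w → #orthogonal w ≡ #orth₀ ℕ.* q ^ j
  #orthogonal-exact≡ w j j<r h ¬h' = trans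
    (NP.+-cancelʳ-≡ (NU ^ a ℕ.* q ^ j) (#orthogonal w) (card ^ a ℕ.* q ^ j ℕ.∸ NU ^ a ℕ.* q ^ j)
      (trans (#orthogonal-exact {a} w j j<r h ¬h') (sym (NP.m∸n+n≡m (NP.*-monoˡ-≤ (q ^ j) NU^a≤card^a)))))
    (sym (NP.*-distribʳ-∸ (q ^ j) (card ^ a) (NU ^ a)))
    where
    NU^a≤card^a : NU ^ a ≤ card ^ a
    NU^a≤card^a = subst₂ _≤_ (NP.*-identityˡ (NU ^ a)) (sym card^a≡q^a*NU^a) (NP.*-monoˡ-≤ (NU ^ a) (NP.m^n>0 q a))

  topJump : ℕ
  topJump = #unimodular d ℕ.∸ #orth₀ ℕ.* q ^ s

  #unimodular≡ : #unimodular d ≡ q ^ s ℕ.* NU ^ a ℕ.* suc t ℕ.* q-1 ℕ.+ #orth₀ ℕ.* q ^ s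
  #unimodular≡ = NP.+-cancelʳ-≡ (q ^ s ℕ.* NU ^ a) (#unimodular d) _ (begin
    #unimodular d ℕ.+ q ^ s ℕ.* NU ^ a ≡⟨ cong (λ z → #unimodular d ℕ.+ z ℕ.* NU ^ a) (sym NU≡q^s) ⟩
    #unimodular d ℕ.+ NU ^ d ≡⟨ #unimodular+NU^d≡card^d d ⟩
    card ℕ.* card ^ a ≡⟨ cong₂ ℕ._*_ card≡q^r (trans card^a≡q^a*NU^a (cong (ℕ._* NU ^ a) q^a≡1+t)) ⟩
    suc q-1 ℕ.* q ^ s ℕ.* (suc t ℕ.* NU ^ a) ≡⟨ expand q-1 (q ^ s) (NU ^ a) t ⟩
    q ^ s ℕ.* NU ^ a ℕ.* suc t ℕ.* q-1 ℕ.+ t ℕ.* NU ^ a ℕ.* q ^ s ℕ.+ q ^ s ℕ.* NU ^ a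
      ≡⟨ cong (λ z → q ^ s ℕ.* NU ^ a ℕ.* suc t ℕ.* q-1 ℕ.+ z ℕ.* q ^ s ℕ.+ q ^ s ℕ.* NU ^ a) (sym #orth₀≡t*NU^a) ⟩
    q ^ s ℕ.* NU ^ a ℕ.* suc t ℕ.* q-1 ℕ.+ #orth₀ ℕ.* q ^ s ℕ.+ q ^ s ℕ.* NU ^ a ∎)
    where
    open ≡-Reasoning
    expand : ∀ Q Qs P t → suc Q ℕ.* Qs ℕ.* (suc t ℕ.* P) ≡ Qs ℕ.* P ℕ.* suc t ℕ.* Q ℕ.+ t ℕ.* P ℕ.* Qs ℕ.+ Qs ℕ.* P
    expand = solve-∀

  topJump≡ : topJump ≡ q ^ s ℕ.* NU ^ a ℕ.* suc t ℕ.* q-1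
  topJump≡ = trans (cong (ℕ._∸ #orth₀ ℕ.* q ^ s) #unimodular≡) (NP.m+n∸n≡m _ (#orth₀ ℕ.* q ^ s))

  card*#orth₀≤#unimodular : card ℕ.* #orth₀ ≤ #unimodular d
  card*#orth₀≤#unimodular = subst₂ _≤_
    (sym (trans (cong₂ ℕ._*_ card≡q^r #orth₀≡t*NU^a) (reorder q (q ^ s) t (NU ^ a))))
    (sym (trans #unimodular≡ (cong (λ z → q ^ s ℕ.* NU ^ a ℕ.* suc t ℕ.* q-1 ℕ.+ z ℕ.* q ^ s) #orth₀≡t*NU^a)))
    (NP.≤-trans (NP.m≤m+n _ _) (NP.≤-reflexive (regroup q-1 (q ^ s) (NU ^ a) t)))
    where
    reorder : ∀ q Qs t P → q ℕ.* Qs ℕ.* (t ℕ.* P) ≡ Qs ℕ.* P ℕ.* t ℕ.* q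
    reorder = solve-∀
    regroup : ∀ Q Qs P t → Qs ℕ.* P ℕ.* t ℕ.* suc Q ℕ.+ Qs ℕ.* P ℕ.* Q ≡ Qs ℕ.* P ℕ.* suc t ℕ.* Q ℕ.+ t ℕ.* P ℕ.* Qs
    regroup = solve-∀

  jump : ℕ → ℕ
  jump k = #orth₀ ℕ.* q-1 ℕ.* q ^ (k ℕ.∸ 1)

  #orth₀*q^j≡ : ∀ j → #orth₀ ℕ.* q ^ j ≡ #orth₀ ℕ.+ ∑₁ j jump
  #orth₀*q^j≡ j = begin
    #orth₀ ℕ.* q ^ j ≡⟨ cong (#orth₀ ℕ.*_) (sym (geometric-sum q-1 j)) ⟩
    #orth₀ ℕ.* (1 ℕ.+ q-1 ℕ.* ∑₁ j (λ k → q ^ (k ℕ.∸ 1))) ≡⟨ distrib #orth₀ q-1 _ ⟩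
    #orth₀ ℕ.+ #orth₀ ℕ.* q-1 ℕ.* ∑₁ j (λ k → q ^ (k ℕ.∸ 1)) ≡⟨ cong (#orth₀ ℕ.+_) (sym (∑₁-*ˡ j (#orth₀ ℕ.* q-1) _)) ⟩
    #orth₀ ℕ.+ ∑₁ j jump ∎
    where
    open ≡-Reasoning
    distrib : ∀ A Q S → A ℕ.* (1 ℕ.+ Q ℕ.* S) ≡ A ℕ.+ A ℕ.* Q ℕ.* S
    distrib = solve-∀

  -- #orthogonal w as a sum of jumps over the levels k with π^k ∣ w (in fact an equality)
  orthBound : Vec Carrier d → ℕ
  orthBound w = #orth₀ ℕ.+ ∑₁ s (λ k → jump k ℕ.* 𝟙 (π^ k ∣ᵛ? w)) ℕ.+ topJump ℕ.* 𝟙 (π^ r ∣ᵛ? w)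

  jumps-below : ∀ {j} n (w : Vec Carrier d) → π^ j ∣ᵛ w → n ≤ j → ∑₁ n jump ≡ ∑₁ n (λ k → jump k ℕ.* 𝟙 (π^ k ∣ᵛ? w))
  jumps-below n w h n≤j = ∑₁-cong n (λ k k≤n →
    sym (trans (cong (jump k ℕ.*_) (𝟙-yes (π^ k ∣ᵛ? w) (π^∣ᵛ-weaken w (NP.≤-trans k≤n n≤j) h))) (NP.*-identityʳ _)))

  #orthogonal≤orthBound : ∀ w → #orthogonal w ≤ orthBound w
  #orthogonal≤orthBound w with exactPower⊎π^r∣ᵛ w
  ... | inj₁ (j , j<r , h , ¬h') = begin
    #orthogonal w ≡⟨ #orthogonal-exact≡ w j j<r h ¬h' ⟩
    #orth₀ ℕ.* q ^ j ≡⟨ #orth₀*q^j≡ j ⟩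
    #orth₀ ℕ.+ ∑₁ j jump ≡⟨ cong (#orth₀ ℕ.+_) (jumps-below j w h NP.≤-refl) ⟩
    #orth₀ ℕ.+ ∑₁ j (λ k → jump k ℕ.* 𝟙 (π^ k ∣ᵛ? w)) ≤⟨ NP.+-monoʳ-≤ #orth₀ (∑₁-monoˡ _ (NP.≤-pred j<r)) ⟩
    #orth₀ ℕ.+ ∑₁ s (λ k → jump k ℕ.* 𝟙 (π^ k ∣ᵛ? w)) ≤⟨ NP.m≤m+n _ _ ⟩
    orthBound w ∎
    where open NP.≤-Reasoning
  ... | inj₂ h = NP.≤-reflexive (begin
    #orthogonal w ≡⟨ #orthogonal-π^r w h ⟩
    #unimodular d ≡⟨ NP.m∸n+n≡m (NP.≤-trans (NP.m≤n+m (#orth₀ ℕ.* q ^ s) (q ^ s ℕ.* NU ^ a ℕ.* suc t ℕ.* q-1)) (NP.≤-reflexive (sym #unimodular≡))) ⟨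
    topJump ℕ.+ #orth₀ ℕ.* q ^ s ≡⟨ NP.+-comm topJump _ ⟩
    #orth₀ ℕ.* q ^ s ℕ.+ topJump ≡⟨ cong (ℕ._+ topJump) (#orth₀*q^j≡ s) ⟩
    #orth₀ ℕ.+ ∑₁ s jump ℕ.+ topJump
      ≡⟨ cong₂ (λ u v → #orth₀ ℕ.+ u ℕ.+ v) (jumps-below s w h (NP.n≤1+n s))
           (sym (trans (cong (topJump ℕ.*_) (𝟙-yes (π^ r ∣ᵛ? w) h)) (NP.*-identityʳ _))) ⟩
    orthBound w ∎)
    where open ≡-Reasoning

  inG² : Vec Carrier d → Vec Carrier d → ℕ
  inG² y y' = 𝟙 (G? y) ℕ.* 𝟙 (G? y')

  ∑unimodular : (Vec Carrier d → ℕ) → ℕ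
  ∑unimodular f = ∑ (allVec d) (λ z → 𝟙 (unimodular? z) ℕ.* f z)

  ∑unimodular-collisions≡ : ∑unimodular collisions ≡ ∑ (allVec d) (λ y → ∑ (allVec d) (λ y' → inG² y y' ℕ.* #orthogonal (y ⊖ y')))
  ∑unimodular-collisions≡ = begin
    ∑unimodular collisions ≡⟨ ∑-cong (allVec d) (λ z → cong (𝟙 (unimodular? z) ℕ.*_) (collisions≡∑coincidence z)) ⟩
    ∑ (allVec d) (λ z → 𝟙 (unimodular? z) ℕ.* ∑ (allVec d) (λ y → ∑ (allVec d) (coincidence z y)))
      ≡⟨ ∑-cong (allVec d) (λ z → trans (sym (∑-*ˡ (allVec d) (𝟙 (unimodular? z)) _))
           (∑-cong (allVec d) (λ y → sym (∑-*ˡ (allVec d) (𝟙 (unimodular? z)) (coincidence z y))))) ⟩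
    ∑ (allVec d) (λ z → ∑ (allVec d) (λ y → ∑ (allVec d) (λ y' → 𝟙 (unimodular? z) ℕ.* coincidence z y y')))
      ≡⟨ trans (∑-swap (allVec d) (allVec d) _) (∑-cong (allVec d) (λ y → ∑-swap (allVec d) (allVec d) _)) ⟩
    ∑ (allVec d) (λ y → ∑ (allVec d) (λ y' → ∑ (allVec d) (λ z → 𝟙 (unimodular? z) ℕ.* coincidence z y y')))
      ≡⟨ ∑-cong (allVec d) (λ y → ∑-cong (allVec d) (λ y' → trans (∑-cong (allVec d) (λ z →
           swap (𝟙 (unimodular? z)) (inG² y y') _)) (∑-*ˡ (allVec d) (inG² y y') _))) ⟩
    ∑ (allVec d) (λ y → ∑ (allVec d) (λ y' → inG² y y' ℕ.* #orthogonal (y ⊖ y'))) ∎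
    where
    open ≡-Reasoning
    swap : ∀ a b c → a ℕ.* (b ℕ.* c) ≡ b ℕ.* (a ℕ.* c)
    swap = solve-∀

  pairsIn : ℕ → ℕ
  pairsIn k = ∑ (allVec d) (λ y → ∑ (allVec d) (λ y' → inG² y y' ℕ.* 𝟙 (π^ k ∣ᵛ? (y ⊖ y'))))

  -- for fixed y, y' ↦ y − y' is a bijection
  pairsIn≤ : ∀ k → pairsIn k ≤ #G ℕ.* #ideal (π^ k) ^ d
  pairsIn≤ k = begin
    pairsIn k ≤⟨ ∑-mono (allVec d) (λ y → ∑-mono (allVec d) (λ y' → NP.*-monoˡ-≤ (𝟙 (π^ k ∣ᵛ? (y ⊖ y'))) (inG²≤ y y'))) ⟩
    ∑ (allVec d) (λ y → ∑ (allVec d) (λ y' → 𝟙 (G? y) ℕ.* 𝟙 (π^ k ∣ᵛ? (y ⊖ y')))) ≡⟨ ∑-cong (allVec d) (λ y → ∑-*ˡ (allVec d) (𝟙 (G? y)) _) ⟩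
    ∑ (allVec d) (λ y → 𝟙 (G? y) ℕ.* ∑ (allVec d) (λ y' → 𝟙 (π^ k ∣ᵛ? (y ⊖ y'))))
      ≡⟨ ∑-cong (allVec d) (λ y → cong (𝟙 (G? y) ℕ.*_) (trans (VecEnumeration.∑-reindex (allVec d) (allVec-isEnum d)
           (y ⊖_) (y ⊖_) (⊖-involutive y) (⊖-involutive y) (λ w → 𝟙 (π^ k ∣ᵛ? w))) (#π^∣ᵛ d k))) ⟩
    ∑ (allVec d) (λ y → 𝟙 (G? y) ℕ.* #ideal (π^ k) ^ d) ≡⟨ ∑-*ʳ (allVec d) _ _ ⟩
    #G ℕ.* #ideal (π^ k) ^ d ∎
    where
    open NP.≤-Reasoning
    inG²≤ : ∀ y y' → inG² y y' ≤ 𝟙 (G? y)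
    inG²≤ y y' = NP.≤-trans (NP.*-monoʳ-≤ (𝟙 (G? y)) (𝟙≤1 (G? y'))) (NP.≤-reflexive (NP.*-identityʳ _))

  ∑₁-∑ : ∀ {A : Set} (l : List A) n (f : A → ℕ → ℕ) → ∑ l (λ x → ∑₁ n (f x)) ≡ ∑₁ n (λ k → ∑ l (λ x → f x k))
  ∑₁-∑ l zero f = ∑-zero l
  ∑₁-∑ l (suc n) f = trans (∑-+ l (λ x → ∑₁ n (f x)) (λ x → f x (suc n))) (cong (ℕ._+ ∑ l (λ x → f x (suc n))) (∑₁-∑ l n f))

  ∑∑inG²*orthBound≡ : ∑ (allVec d) (λ y → ∑ (allVec d) (λ y' → inG² y y' ℕ.* orthBound (y ⊖ y')))
                      ≡ #orth₀ ℕ.* (#G ℕ.* #G) ℕ.+ ∑₁ s (λ k → jump k ℕ.* pairsIn k) ℕ.+ topJump ℕ.* pairsIn r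
  ∑∑inG²*orthBound≡ = begin
    ∑∑ (λ y y' → inG² y y' ℕ.* orthBound (y ⊖ y')) ≡⟨ ∑-cong (allVec d) (λ y → ∑-cong (allVec d) (λ y' → distribute y y')) ⟩
    ∑∑ (λ y y' → T₀ y y' ℕ.+ T₁ y y' ℕ.+ T₂ y y') ≡⟨ split ⟩
    ∑∑ T₀ ℕ.+ ∑∑ T₁ ℕ.+ ∑∑ T₂ ≡⟨ cong₂ ℕ._+_ (cong₂ ℕ._+_ ∑∑T₀ ∑∑T₁) ∑∑T₂ ⟩
    #orth₀ ℕ.* (#G ℕ.* #G) ℕ.+ ∑₁ s (λ k → jump k ℕ.* pairsIn k) ℕ.+ topJump ℕ.* pairsIn r ∎
    where
    open ≡-Reasoning
    ∑∑ : (Vec Carrier d → Vec Carrier d → ℕ) → ℕ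
    ∑∑ f = ∑ (allVec d) (λ y → ∑ (allVec d) (f y))
    T₀ T₁ T₂ : Vec Carrier d → Vec Carrier d → ℕ
    T₀ y y' = #orth₀ ℕ.* inG² y y'
    T₁ y y' = ∑₁ s (λ k → jump k ℕ.* (inG² y y' ℕ.* 𝟙 (π^ k ∣ᵛ? (y ⊖ y'))))
    T₂ y y' = topJump ℕ.* (inG² y y' ℕ.* 𝟙 (π^ r ∣ᵛ? (y ⊖ y')))
    distrib : ∀ g A S e h → g ℕ.* (A ℕ.+ S ℕ.+ e ℕ.* h) ≡ A ℕ.* g ℕ.+ g ℕ.* S ℕ.+ e ℕ.* (g ℕ.* h)
    distrib = solve-∀
    swap : ∀ g w h → g ℕ.* (w ℕ.* h) ≡ w ℕ.* (g ℕ.* h)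
    swap = solve-∀
    distribute : ∀ y y' → inG² y y' ℕ.* orthBound (y ⊖ y') ≡ T₀ y y' ℕ.+ T₁ y y' ℕ.+ T₂ y y'
    distribute y y' = trans (distrib (inG² y y') #orth₀ _ topJump _)
      (cong (λ z → T₀ y y' ℕ.+ z ℕ.+ T₂ y y')
        (trans (sym (∑₁-*ˡ s (inG² y y') _)) (∑₁-cong s (λ k _ → swap (inG² y y') (jump k) _))))
    split : ∑∑ (λ y y' → T₀ y y' ℕ.+ T₁ y y' ℕ.+ T₂ y y') ≡ ∑∑ T₀ ℕ.+ ∑∑ T₁ ℕ.+ ∑∑ T₂
    split = trans (∑-cong (allVec d) (λ y → trans (∑-+ (allVec d) _ (T₂ y)) (cong (ℕ._+ ∑ (allVec d) (T₂ y)) (∑-+ (allVec d) (T₀ y) (T₁ y)))))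
                  (trans (∑-+ (allVec d) _ _) (cong (ℕ._+ ∑∑ T₂) (∑-+ (allVec d) _ _)))
    ∑∑T₀ : ∑∑ T₀ ≡ #orth₀ ℕ.* (#G ℕ.* #G)
    ∑∑T₀ = trans (∑-cong (allVec d) (λ y → ∑-*ˡ (allVec d) #orth₀ (inG² y)))
             (trans (∑-*ˡ (allVec d) #orth₀ _) (cong (#orth₀ ℕ.*_) (sym (∑*∑ (allVec d) (allVec d) _ _))))
    ∑∑T₁ : ∑∑ T₁ ≡ ∑₁ s (λ k → jump k ℕ.* pairsIn k)
    ∑∑T₁ = trans (∑-cong (allVec d) (λ y → ∑₁-∑ (allVec d) s _)) (trans (∑₁-∑ (allVec d) s _)
             (∑₁-cong s (λ k _ → trans (∑-cong (allVec d) (λ y → ∑-*ˡ (allVec d) (jump k) _)) (∑-*ˡ (allVec d) (jump k) _))))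
    ∑∑T₂ : ∑∑ T₂ ≡ topJump ℕ.* pairsIn r
    ∑∑T₂ = trans (∑-cong (allVec d) (λ y → ∑-*ˡ (allVec d) topJump _)) (∑-*ˡ (allVec d) topJump _)

  ∑unimodular-collisions≤ : ∑unimodular collisions
    ≤ #orth₀ ℕ.* (#G ℕ.* #G) ℕ.+ ∑₁ s (λ k → jump k ℕ.* (#G ℕ.* #ideal (π^ k) ^ d)) ℕ.+ topJump ℕ.* (#G ℕ.* #ideal (π^ r) ^ d)
  ∑unimodular-collisions≤ = begin
    ∑unimodular collisions ≡⟨ ∑unimodular-collisions≡ ⟩
    ∑ (allVec d) (λ y → ∑ (allVec d) (λ y' → inG² y y' ℕ.* #orthogonal (y ⊖ y')))
      ≤⟨ ∑-mono (allVec d) (λ y → ∑-mono (allVec d) (λ y' → NP.*-monoʳ-≤ (inG² y y') (#orthogonal≤orthBound (y ⊖ y')))) ⟩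
    ∑ (allVec d) (λ y → ∑ (allVec d) (λ y' → inG² y y' ℕ.* orthBound (y ⊖ y'))) ≡⟨ ∑∑inG²*orthBound≡ ⟩
    #orth₀ ℕ.* (#G ℕ.* #G) ℕ.+ ∑₁ s (λ k → jump k ℕ.* pairsIn k) ℕ.+ topJump ℕ.* pairsIn r
      ≤⟨ NP.+-mono-≤ (NP.+-monoʳ-≤ (#orth₀ ℕ.* (#G ℕ.* #G)) (∑₁-mono s (λ k _ → NP.*-monoʳ-≤ (jump k) (pairsIn≤ k))))
                     (NP.*-monoʳ-≤ topJump (pairsIn≤ r)) ⟩
    #orth₀ ℕ.* (#G ℕ.* #G) ℕ.+ ∑₁ s (λ k → jump k ℕ.* (#G ℕ.* #ideal (π^ k) ^ d)) ℕ.+ topJump ℕ.* (#G ℕ.* #ideal (π^ r) ^ d) ∎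
    where open NP.≤-Reasoning

  Y : ℕ
  Y = q ℕ.* suc t

  q^d≡Y : q ^ d ≡ Y
  q^d≡Y = cong (q ℕ.*_) q^a≡1+t

  #ideal-π^k≡q^[r∸k] : ∀ k → k ≤ r → #ideal (π^ k) ≡ q ^ (r ℕ.∸ k)
  #ideal-π^k≡q^[r∸k] k k≤r = NP.*-cancelʳ-≡ (#ideal (π^ k)) (q ^ (r ℕ.∸ k)) (q ^ k) {{NP.m^n≢0 q k}}
    (trans (#ideal-π^k*q^k≡q^r k k≤r) (trans (cong (q ^_) (sym (NP.m∸n+n≡m k≤r))) (NP.^-distribˡ-+-* q (r ℕ.∸ k) k)))

  #ideal-π^r^d≡1 : #ideal (π^ r) ^ d ≡ 1
  #ideal-π^r^d≡1 = trans (cong (_^ d) (trans (#ideal-π^k≡q^[r∸k] r NP.≤-refl) (cong (q ^_) (NP.n∸n≡0 r)))) (NP.^-zeroˡ d)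

  #ideal-π^k^d≡ : ∀ k → k ≤ s → #ideal (π^ k) ^ d ≡ Y ℕ.* Y ^ (s ℕ.∸ k)
  #ideal-π^k^d≡ k k≤s = begin
    #ideal (π^ k) ^ d ≡⟨ cong (_^ d) (#ideal-π^k≡q^[r∸k] k (NP.m≤n⇒m≤1+n k≤s)) ⟩
    (q ^ (r ℕ.∸ k)) ^ d ≡⟨ ^-comm q (r ℕ.∸ k) d ⟩
    (q ^ d) ^ (r ℕ.∸ k) ≡⟨ cong₂ _^_ q^d≡Y (NP.+-∸-assoc 1 k≤s) ⟩
    Y ^ suc (s ℕ.∸ k) ∎
    where open ≡-Reasoning

  ∑jump*#pairs≡ : ∑₁ s (λ k → jump k ℕ.* (#G ℕ.* #ideal (π^ k) ^ d)) ≡ #G ℕ.* (#orth₀ ℕ.* q-1 ℕ.* Y ℕ.* mixedPowerSum q Y s)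
  ∑jump*#pairs≡ = begin
    ∑₁ s (λ k → jump k ℕ.* (#G ℕ.* #ideal (π^ k) ^ d))
      ≡⟨ ∑₁-cong s (λ k k≤s → trans (cong (λ z → jump k ℕ.* (#G ℕ.* z)) (#ideal-π^k^d≡ k k≤s))
           (regroup #orth₀ q-1 (q ^ (k ℕ.∸ 1)) #G Y (Y ^ (s ℕ.∸ k)))) ⟩
    ∑₁ s (λ k → #G ℕ.* (#orth₀ ℕ.* q-1 ℕ.* Y) ℕ.* (q ^ (k ℕ.∸ 1) ℕ.* Y ^ (s ℕ.∸ k))) ≡⟨ ∑₁-*ˡ s (#G ℕ.* (#orth₀ ℕ.* q-1 ℕ.* Y)) (λ k → q ^ (k ℕ.∸ 1) ℕ.* Y ^ (s ℕ.∸ k)) ⟩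
    #G ℕ.* (#orth₀ ℕ.* q-1 ℕ.* Y) ℕ.* mixedPowerSum q Y s ≡⟨ NP.*-assoc #G _ _ ⟩
    #G ℕ.* (#orth₀ ℕ.* q-1 ℕ.* Y ℕ.* mixedPowerSum q Y s) ∎
    where
    open ≡-Reasoning
    regroup : ∀ A Q p c Y y → A ℕ.* Q ℕ.* p ℕ.* (c ℕ.* (Y ℕ.* y)) ≡ c ℕ.* (A ℕ.* Q ℕ.* Y) ℕ.* (p ℕ.* y)
    regroup = solve-∀

  K : ℕ
  K = q ^ ((d ℕ.∸ 1) ℕ.* (2 ℕ.* r ℕ.∸ 1))

  [1+t]^s≡NU^a : suc t ^ s ≡ NU ^ a
  [1+t]^s≡NU^a = trans (cong (_^ s) (sym q^a≡1+t)) (trans (^-comm q a s) (cong (_^ a) (sym NU≡q^s)))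

  K≡ : K ≡ suc t ℕ.* (NU ^ a ℕ.* NU ^ a)
  K≡ = begin
    q ^ (a ℕ.* (2 ℕ.* suc s ℕ.∸ 1)) ≡⟨ cong (λ e → q ^ (a ℕ.* e)) 2[1+s]∸1≡1+s+s ⟩
    q ^ (a ℕ.* suc (s ℕ.+ s)) ≡⟨ NP.^-*-assoc q a (suc (s ℕ.+ s)) ⟨
    (q ^ a) ^ suc (s ℕ.+ s) ≡⟨ cong (q ^ a ℕ.*_) (NP.^-distribˡ-+-* (q ^ a) s s) ⟩
    q ^ a ℕ.* ((q ^ a) ^ s ℕ.* (q ^ a) ^ s) ≡⟨ cong₂ (λ u v → u ℕ.* (v ℕ.* v)) q^a≡1+t (trans (cong (_^ s) q^a≡1+t) [1+t]^s≡NU^a) ⟩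
    suc t ℕ.* (NU ^ a ℕ.* NU ^ a) ∎
    where
    open ≡-Reasoning
    2[1+s]∸1≡1+s+s : 2 ℕ.* suc s ℕ.∸ 1 ≡ suc (s ℕ.+ s)
    2[1+s]∸1≡1+s+s = trans (cong (s ℕ.+_) (NP.*-identityˡ (suc s))) (NP.+-suc s s)

  -- the identity in which the exponent (d − 1)(2r − 1) of the theorem appears
  levels-total : #orth₀ ℕ.* q-1 ℕ.* Y ℕ.* mixedPowerSum q Y s ℕ.+ topJump ≡ #units ℕ.* K
  levels-total = begin
    #orth₀ ℕ.* q-1 ℕ.* Y ℕ.* S ℕ.+ topJump ≡⟨ cong₂ (λ u v → u ℕ.* q-1 ℕ.* Y ℕ.* S ℕ.+ v) #orth₀≡t*NU^a topJump≡ ⟩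
    t ℕ.* P ℕ.* q-1 ℕ.* (q ℕ.* suc t) ℕ.* S ℕ.+ q ^ s ℕ.* P ℕ.* suc t ℕ.* q-1 ≡⟨ factor t P q-1 S (q ^ s) ⟩
    P ℕ.* q-1 ℕ.* suc t ℕ.* (t ℕ.* q ℕ.* S ℕ.+ q ^ s)
      ≡⟨ cong (P ℕ.* q-1 ℕ.* suc t ℕ.*_) (trans (mixedPowerSum-difference q-1 t s) Y^s≡q^s*NU^a) ⟩
    P ℕ.* q-1 ℕ.* suc t ℕ.* (q ^ s ℕ.* P) ≡⟨ reorder P q-1 t (q ^ s) ⟩
    q-1 ℕ.* q ^ s ℕ.* (suc t ℕ.* (P ℕ.* P)) ≡⟨ cong₂ ℕ._*_ #units≡q-1*q^s K≡ ⟨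
    #units ℕ.* K ∎
    where
    open ≡-Reasoning
    P = NU ^ a
    S = mixedPowerSum q Y s
    Y^s≡q^s*NU^a : Y ^ s ≡ q ^ s ℕ.* NU ^ a
    Y^s≡q^s*NU^a = trans (^-distribʳ-* q (suc t) s) (cong (q ^ s ℕ.*_) [1+t]^s≡NU^a)
    factor : ∀ t P Q S Qs → t ℕ.* P ℕ.* Q ℕ.* (suc Q ℕ.* suc t) ℕ.* S ℕ.+ Qs ℕ.* P ℕ.* suc t ℕ.* Q
                          ≡ P ℕ.* Q ℕ.* suc t ℕ.* (t ℕ.* suc Q ℕ.* S ℕ.+ Qs)
    factor = solve-∀
    reorder : ∀ P Q t Qs → P ℕ.* Q ℕ.* suc t ℕ.* (Qs ℕ.* P) ≡ Q ℕ.* Qs ℕ.* (suc t ℕ.* (P ℕ.* P))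
    reorder = solve-∀

  ∑unimodular-excess+ : ∑unimodular excess ℕ.+ #unimodular d ℕ.* (#G ℕ.* #G) ≡ card ℕ.* ∑unimodular collisions
  ∑unimodular-excess+ = begin
    ∑unimodular excess ℕ.+ #unimodular d ℕ.* (#G ℕ.* #G) ≡⟨ cong (∑unimodular excess ℕ.+_) (sym (∑-*ʳ (allVec d) (#G ℕ.* #G) _)) ⟩
    ∑unimodular excess ℕ.+ ∑unimodular (λ _ → #G ℕ.* #G) ≡⟨ sym (∑-+ (allVec d) _ _) ⟩
    ∑ (allVec d) (λ z → 𝟙 (unimodular? z) ℕ.* excess z ℕ.+ 𝟙 (unimodular? z) ℕ.* (#G ℕ.* #G))
      ≡⟨ ∑-cong (allVec d) (λ z → trans (sym (NP.*-distribˡ-+ (𝟙 (unimodular? z)) (excess z) _))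
           (trans (cong (𝟙 (unimodular? z) ℕ.*_) (excess+#G²≡card*collisions z)) (swap (𝟙 (unimodular? z)) card (collisions z)))) ⟩
    ∑ (allVec d) (λ z → card ℕ.* (𝟙 (unimodular? z) ℕ.* collisions z)) ≡⟨ ∑-*ˡ (allVec d) card _ ⟩
    card ℕ.* ∑unimodular collisions ∎
    where
    open ≡-Reasoning
    swap : ∀ a b c → a ℕ.* (b ℕ.* c) ≡ b ℕ.* (a ℕ.* c)
    swap = solve-∀

  ∑unimodular-excess≤ : ∑unimodular excess ≤ card ℕ.* #G ℕ.* (#units ℕ.* K)
  ∑unimodular-excess≤ = NP.+-cancelʳ-≤ (#unimodular d ℕ.* (#G ℕ.* #G)) _ _ (begin
    ∑unimodular excess ℕ.+ #unimodular d ℕ.* (#G ℕ.* #G) ≡⟨ ∑unimodular-excess+ ⟩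
    card ℕ.* ∑unimodular collisions ≤⟨ NP.*-monoʳ-≤ card ∑unimodular-collisions≤ ⟩
    card ℕ.* (#orth₀ ℕ.* (#G ℕ.* #G) ℕ.+ ∑₁ s (λ k → jump k ℕ.* (#G ℕ.* #ideal (π^ k) ^ d)) ℕ.+ topJump ℕ.* (#G ℕ.* #ideal (π^ r) ^ d))
      ≡⟨ cong₂ (λ u v → card ℕ.* (#orth₀ ℕ.* (#G ℕ.* #G) ℕ.+ u ℕ.+ topJump ℕ.* (#G ℕ.* v))) ∑jump*#pairs≡ #ideal-π^r^d≡1 ⟩
    card ℕ.* (#orth₀ ℕ.* (#G ℕ.* #G) ℕ.+ #G ℕ.* L ℕ.+ topJump ℕ.* (#G ℕ.* 1)) ≡⟨ distrib card #orth₀ #G L topJump ⟩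
    card ℕ.* #orth₀ ℕ.* (#G ℕ.* #G) ℕ.+ card ℕ.* #G ℕ.* (L ℕ.+ topJump)
      ≤⟨ NP.+-monoˡ-≤ _ (NP.*-monoˡ-≤ (#G ℕ.* #G) card*#orth₀≤#unimodular) ⟩
    #unimodular d ℕ.* (#G ℕ.* #G) ℕ.+ card ℕ.* #G ℕ.* (L ℕ.+ topJump)
      ≡⟨ trans (cong (λ z → #unimodular d ℕ.* (#G ℕ.* #G) ℕ.+ card ℕ.* #G ℕ.* z) levels-total) (NP.+-comm (#unimodular d ℕ.* (#G ℕ.* #G)) _) ⟩
    card ℕ.* #G ℕ.* (#units ℕ.* K) ℕ.+ #unimodular d ℕ.* (#G ℕ.* #G) ∎)
    where
    open NP.≤-Reasoning
    L = #orth₀ ℕ.* q-1 ℕ.* Y ℕ.* mixedPowerSum q Y s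
    distrib : ∀ c A g S e → c ℕ.* (A ℕ.* (g ℕ.* g) ℕ.+ g ℕ.* S ℕ.+ e ℕ.* (g ℕ.* 1)) ≡ c ℕ.* A ℕ.* (g ℕ.* g) ℕ.+ c ℕ.* g ℕ.* (S ℕ.+ e)
    distrib = solve-∀

module Estimate (R : FiniteChainRing) (q' s : Data.Nat.ℕ)
  (card≡q^r : FCR.card R PEq.≡ (2 Data.Nat.+ q') Data.Nat.^ Data.Nat.suc s)
  (card≡q*cardNonUnits : FCR.card R PEq.≡ (2 Data.Nat.+ q') Data.Nat.* FCR.cardNonUnits R)
  (a : Data.Nat.ℕ) {F G : Relation.Unary.Pred (Data.Vec.Vec (FiniteChainRing.Carrier R) (Data.Nat.suc a)) Level.0ℓ}
  (F? : Relation.Unary.Decidable F) (G? : Relation.Unary.Decidable G)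
  (F-unimodular : ∀ x → F x → Relation.Nullary.¬ FCR.AllNonUnit R x) where

  open import Data.Nat as ℕ using (suc; _≤_; _^_)
  import Data.Nat.Properties as NP
  open import Data.Nat.Tactic.RingSolver using (solve-∀)
  open import Relation.Binary.PropositionalEquality
  open FiniteSums using (∑)
  open ChainRingSize R q' (suc s) card≡q^r card≡q*cardNonUnits using (q; card; count; maxLine; sumν²; #units)
  open UnimodularExcess R q' s card≡q^r card≡q*cardNonUnits a F? G?
    using (q-1; K; #units≡q-1*q^s; ∑unimodular-excess≤)
  open Energy R (suc a) F? G?
  open LineAveraging R (suc a) F? G? F-unimodular

  instance
    #units≢0 : ℕ.NonZero #units
    #units≢0 = subst ℕ.NonZero (sym #units≡q-1*q^s) (NP.m*n≢0 q-1 (q ^ s) {{_}} {{NP.m^n≢0 q s}})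

  ∑excess≤ : ∑ Fs excess ≤ maxLine F? ℕ.* card ℕ.* #G ℕ.* K
  ∑excess≤ = NP.*-cancelˡ-≤ #units
    (NP.≤-trans #units*∑excess≤ (NP.≤-trans (NP.*-monoʳ-≤ (maxLine F?) ∑unimodular-excess≤)
      (NP.≤-reflexive (reorder (maxLine F?) card #G #units K))))
    where
    reorder : ∀ M c g u K → M ℕ.* (c ℕ.* g ℕ.* (u ℕ.* K)) ≡ u ℕ.* (M ℕ.* c ℕ.* g ℕ.* K)
    reorder = solve-∀

  bound : q ^ suc s ℕ.* sumν² F? G?
          ≤ (count F? ℕ.* count F?) ℕ.* (count G? ℕ.* count G?) ℕ.+ q ^ suc s ℕ.* (K ℕ.* count F? ℕ.* count G? ℕ.* maxLine F?)
  bound = subst₂ _≤_ (cong (ℕ._* sumν² F? G?) card≡q^r) rearrange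
    (NP.≤-trans card*sumν²≤ (NP.+-monoʳ-≤ ((#F ℕ.* #G) ℕ.* (#F ℕ.* #G)) (NP.*-monoʳ-≤ #F ∑excess≤)))
    where
    regroup : ∀ f g M c K → (f ℕ.* g) ℕ.* (f ℕ.* g) ℕ.+ f ℕ.* (M ℕ.* c ℕ.* g ℕ.* K) ≡ (f ℕ.* f) ℕ.* (g ℕ.* g) ℕ.+ c ℕ.* (K ℕ.* f ℕ.* g ℕ.* M)
    regroup = solve-∀
    rearrange : (#F ℕ.* #G) ℕ.* (#F ℕ.* #G) ℕ.+ #F ℕ.* (maxLine F? ℕ.* card ℕ.* #G ℕ.* K)
              ≡ (count F? ℕ.* count F?) ℕ.* (count G? ℕ.* count G?) ℕ.+ q ^ suc s ℕ.* (K ℕ.* count F? ℕ.* count G? ℕ.* maxLine F?)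
    rearrange = trans (regroup #F #G (maxLine F?) card K)
      (trans (cong (λ c → (#F ℕ.* #F) ℕ.* (#G ℕ.* #G) ℕ.+ c ℕ.* (K ℕ.* #F ℕ.* #G ℕ.* maxLine F?)) card≡q^r)
             (cong₂ (λ f g → (f ℕ.* f) ℕ.* (g ℕ.* g) ℕ.+ q ^ suc s ℕ.* (K ℕ.* f ℕ.* g ℕ.* maxLine F?)) (sym count-F≡#F) (sym count-G≡#G)))

module DimensionZero (R : FiniteChainRing)
  {F G : Relation.Unary.Pred (Data.Vec.Vec (FiniteChainRing.Carrier R) 0) Level.0ℓ}
  (F? : Relation.Unary.Decidable F) (G? : Relation.Unary.Decidable G)
  (F-unimodular : ∀ x → F x → Relation.Nullary.¬ FCR.AllNonUnit R x) where

  open import Data.Nat as ℕ using (_≤_; z≤n)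
  import Data.Nat.Properties as NP
  open import Data.Empty using (⊥-elim)
  open import Data.Vec using ([])
  open import Data.Vec.Relation.Unary.All using ([])
  open import Relation.Nullary using (yes; no)
  open import Relation.Binary.PropositionalEquality
  open FCR R using (card; sumν²)
  open FiniteSums using (∑)
  open Energy R 0 F? G?

  -- the only vector of length 0 lies in (R⁰)⁰
  #F≡0 : #F ≡ 0
  #F≡0 with F? []
  ... | yes F[] = ⊥-elim (F-unimodular [] F[] [])
  ... | no _ = refl

  bound : ∀ {n} → card ≡ n → ∀ m → n ℕ.* sumν² F? G? ≤ m
  bound refl m = subst (_≤ m) (sym (NP.n≤0⇒n≡0 (subst (card ℕ.* sumν² F? G? ≤_)
    (cong (λ f → f ℕ.* #G ℕ.* (f ℕ.* #G) ℕ.+ f ℕ.* ∑ Fs excess) #F≡0) card*sumν²≤))) z≤n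

open import Level using (0ℓ)
open import Data.Nat using (ℕ; zero; suc; _+_; _*_; _∸_; _^_; _≤_; z≤n; s≤s)
open import Data.Nat.Properties using (≤-trans; ^-identityʳ; ^-monoʳ-≤)
open import Data.Nat.Primality using (prime⇒nonZero; prime⇒nonTrivial)
open import Data.Vec using (Vec)
open import Data.Product using (_,_)
open import Data.Empty using (⊥-elim)
open import Relation.Unary using (Pred; Decidable)
open import Relation.Nullary using (¬_)
open import Relation.Binary.PropositionalEquality using (_≡_; refl; sym; subst)

oddPrimePower⇒2≤q : ∀ {q} → OddPrimePower q → 2 ≤ q
oddPrimePower⇒2≤q (p , k , p-prime , _ , 1≤k , q≡p^k) = subst (2 ≤_) (sym q≡p^k)
  (≤-trans (Data.Nat.nonTrivial⇒n>1 p {{prime⇒nonTrivial p-prime}})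
    (subst (_≤ p ^ k) (^-identityʳ p) (^-monoʳ-≤ p {{prime⇒nonZero p-prime}} 1≤k)))

theorem2p5 : (R : FiniteChainRing) → let module Rg = FCR R in
    (q r : ℕ) → OddPrimePower q → Rg.card ≡ q ^ r → Rg.card ≡ q * Rg.cardNonUnits →
    (d : ℕ) (F G : Pred (Vec Rg.Carrier d) 0ℓ) (F? : Decidable F) (G? : Decidable G) →
    (∀ x → F x → ¬ Rg.AllNonUnit x) →
    q ^ r * Rg.sumν² F? G?
      ≤ (Rg.count F? * Rg.count F?) * (Rg.count G? * Rg.count G?)
        + q ^ r * (q ^ ((d ∸ 1) * (2 * r ∸ 1)) * Rg.count F? * Rg.count G? * Rg.maxLine F?)
theorem2p5 R q r opp card≡q^r card≡q*NU d F G F? G? F-unimodular with oddPrimePower⇒2≤q opp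
theorem2p5 R _ zero _ card≡q^r card≡q*NU _ _ _ _ _ _ | s≤s (s≤s (z≤n {q'})) =
  ⊥-elim (ChainRingSize.r≢0 R q' zero card≡q^r card≡q*NU refl)
theorem2p5 R _ (suc s) _ card≡q^r card≡q*NU zero _ _ F? G? F-unimodular | s≤s (s≤s z≤n) =
  DimensionZero.bound R F? G? F-unimodular card≡q^r _
theorem2p5 R _ (suc s) _ card≡q^r card≡q*NU (suc a) _ _ F? G? F-unimodular | s≤s (s≤s (z≤n {q'})) =
  Estimate.bound R q' s card≡q^r card≡q*NU a F? G? F-unimodular
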